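{- Let $t,u\in\mathfrak S_n$ with $t\le_W u$. Then for all $v,w\in\mathfrak S_n$ and every reduced expression $s_{i_1}\cdots s_{i_k}$ for $ut^{ -1}$, $$r_{u,v,t,w}(q_1)=p_{u,v,t,w}(q_1;s_{i_1}\cdots s_{i_k}).$$ In particular $p_{u,v,t,w}(q_1;s_{i_1}\cdots s_{i_k})$ does not depend on the chosen reduced expression.
   Context: $\mathfrak S_n$ is generated by adjacent transpositions $s_1,\dots,s_{n-1}$; the one-line notation $w_1\cdots w_n$ of $w$ is obtained by letting an expression for $w$ act on the word $1\cdots n$, $s_j$ swapping letters in positions $j,j+1$. $\le$ is Bruhat order, $\le_W$ the weak order ($u\le_W v$ iff some reduced expression of $v$ ends with a reduced expression of $u$). The quantum matrix bialgebra $\mathcal A$ is the associative unital $\mathbb Z[q^{1/2},q^{ -1/2}]$-algebra generated by $x_{i,j}$ ($1\le i,j\le n$) with relations, for $i<j$, $k<\ell$: $x_{i,\ell}x_{i,k}=q^{1/2}x_{i,k}x_{i,\ell}$, $x_{j,k}x_{i,\ell}=x_{i,\ell}x_{j,k}$, $x_{j,k}x_{i,k}=q^{1/2}x_{i,k}x_{j,k}$, $x_{j,\ell}x_{i,k}=x_{i,k}x_{j,\ell}+(q^{1/2}-q^{ -1/2})x_{i,\ell}x_{j,k}$. Put $x^{u,v}=x_{u_1,v_1}\cdots x_{u_n,v_n}$. For fixed $t$, $\{x^{t,w}\}_{w\in\mathfrak S_n}$ is a basis of the span of all $x^{u,v}$, and for $t\le_W u$ there are unique polynomials $r_{u,v,t,w}(q_1)\in\mathbb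 N[q_1]$ with $x^{u,v}=\sum_w r_{u,v,t,w}(q^{1/2}-q^{ -1/2})x^{t,w}$. For a reduced expression $s_{i_1}\cdots s_{i_k}$ of $ut^{ -1}$, $C^b_{u,v,t,w}(s_{i_1}\cdots s_{i_k})$ is the set of sequences $(\pi^{(0)},\dots,\pi^{(k)})$ with $\pi^{(0)}=v$, $\pi^{(k)}=w$, $\pi^{(j)}\in\{s_{i_j}\pi^{(j-1)},\pi^{(j-1)}\}$, $\pi^{(j)}=s_{i_j}\pi^{(j-1)}$ whenever $s_{i_j}\pi^{(j-1)}>\pi^{(j-1)}$, and $\pi^{(j)}=\pi^{(j-1)}$ for exactly $b$ indices $j$; and $p_{u,v,t,w}(q_1;s_{i_1}\cdots s_{i_k})=\sum_b|C^b_{u,v,t,w}(s_{i_1}\cdots s_{i_k})|q_1^b$. -}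

module Defs where

open import Data.Nat using (ℕ; zero; suc; _≤_; _<_)
open import Data.Fin as Fin using (Fin; inject₁)
open import Data.Fin.Properties using () renaming (_≟_ to _≟F_)
open import Data.Empty using (⊥)
open import Data.Product using (Σ; ∃; ∃-syntax; _×_; _,_)
open import Data.Sum using (_⊎_)
open import Data.Vec as Vec using (Vec; []; _∷_; lookup; _[_]≔_; toList)
open import Data.List as List using (List; []; _∷_; _++_; length; filter; concatMap; foldr)
open import Data.List.Membership.Propositional using (_∈_)
open import Data.List.Relation.Binary.Sublist.Propositional using (_⊆_)
open import Data.List.Relation.Unary.Unique.Propositional using (Unique)
import Data.List.Relation.Unary.Unique.DecPropositional as UDec
open import Relation.Binary.PropositionalEquality using (_≡_; _≢_)
open import Relation.Nullary using (¬_)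

-- Permutations of {1..n}, in one-line notation.
-- Positions and letters are 0-based: Fin n = {0,..,n-1} stands for {1,..,n}.
-- A word w : Word n is the one-line notation w_1 ⋯ w_n (w_i = lookup w i).

Word : ℕ → Set
Word n = Vec (Fin n) n

IsPerm : ∀ {n} → Word n → Set
IsPerm w = Unique (toList w)

idW : ∀ n → Word n
idW n = Vec.allFin n

-- Product in 𝔖_n with the convention of the paper: the one-line notation of
-- a·b is obtained by letting (an expression of) a act on the word of b,
-- s_j swapping the letters in positions j, j+1.  Explicitly (a·b)_i = b_{a_i}.
_·_ : ∀ {n} → Word n → Word n → Word n
a · b = Vec.map (lookup b) a

infixr 8 _·_
infix 4 _≤B_ _<B_ _≤W_

-- Indices of the adjacent transpositions s_1,…,s_{n-1}: Gen n has n-1 elements.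
-- (The index j : Fin m stands for s_{j+1}, swapping positions j and j+1 (0-based).)
Gen : ℕ → Set
Gen zero = ⊥
Gen (suc m) = Fin m

gen : ∀ {n} → Gen n → Word n
gen {zero} ()
gen {suc m} j =
  (idW (suc m) [ inject₁ j ]≔ Fin.suc j) [ Fin.suc j ]≔ inject₁ j

eval : ∀ {n} → List (Gen n) → Word n
eval {n} []      = idW n
eval     (j ∷ e) = gen j · eval e

Reduced : ∀ {n} → List (Gen n) → Word n → Set
Reduced {n} e g = (eval e ≡ g) × (∀ (e' : List (Gen n)) → eval e' ≡ g → length e ≤ length e')

-- e is a reduced expression for u t⁻¹  (eval e = u t⁻¹  ⇔  eval e · t = u)
ReducedQuot : ∀ {n} → List (Gen n) → Word n → Word n → Set
ReducedQuot {n} e u t =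
  (eval e · t ≡ u) × (∀ (e' : List (Gen n)) → eval e' · t ≡ u → length e ≤ length e')

_≤W_ : ∀ {n} → Word n → Word n → Set
_≤W_ {n} u v = ∃[ e₁ ] ∃[ e₂ ] (Reduced {n} e₂ u × Reduced (e₁ ++ e₂) v)

_≤B_ : ∀ {n} → Word n → Word n → Set
_≤B_ {n} u v = ∃[ e ] ∃[ e' ] (Reduced {n} e v × e' ⊆ e × Reduced e' u)

_<B_ : ∀ {n} → Word n → Word n → Set
u <B v = (u ≤B v) × (u ≢ v)

-- Steps e π rest w b : the sequence  π ∷ rest  is a valid continuation
-- (π^{(j-1)}, π^{(j)}, …, π^{(k)}) along the remaining letters e, ending at w,
-- staying put at exactly b of the remaining indices.

Steps : ∀ {n} → List (Gen n) → Word n → List (Word n) → Word n → ℕ → Set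
Steps []      π []          w b = (π ≡ w) × (b ≡ 0)
Steps []      π (_ ∷ _)     w b = ⊥
Steps (j ∷ e) π []          w b = ⊥
Steps (j ∷ e) π (π' ∷ rest) w b =
    ((π' ≡ gen j · π) × Steps e π' rest w b)
  ⊎ ((π' ≡ π) × ¬ (π <B gen j · π) × (∃[ b' ] ((b ≡ suc b') × Steps e π' rest w b')))

-- σ = (π^{(0)}, …, π^{(k)}) ∈ C^b_{u,v,t,w}(e)   (u,t only enter through e)
InC : ∀ {n} → List (Gen n) → Word n → Word n → ℕ → List (Word n) → Set
InC e v w b []       = ⊥
InC e v w b (π ∷ σ) = (π ≡ v) × Steps e π σ w b

HasSize : ∀ {A : Set} → (A → Set) → ℕ → Set
HasSize {A} P m = Σ (List A) λ L → Unique L × (length L ≡ m) ×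
                     (∀ x → (P x → x ∈ L) × (x ∈ L → P x))

allVecs : ∀ {n} k → List (Vec (Fin n) k)
allVecs zero    = [] ∷ []
allVecs {n} (suc k) = concatMap (λ x → List.map (x ∷_) (allVecs k)) (List.allFin n)

Sn : ∀ n → List (Word n)
Sn n = filter (λ w → UDec.unique? _≟F_ (toList w)) (allVecs n)

-- The quantum matrix bialgebra 𝒜, presented by generators and relations:
-- the free unital (noncommutative) ring on x_{i,j} and on Q = q^{1/2},
-- Q' = q^{-1/2}, modulo: ring axioms, Q central, Q Q' = Q' Q = 1, and the
-- four quantum-matrix relations.  (A ℤ-ring with a central unit Q is the
-- same as a ℤ[q^{1/2},q^{-1/2}]-algebra.)  Equality in 𝒜 is _≈_.

infixl 6 _⊕_
infixl 7 _⊗_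

data Tm (n : ℕ) : Set where
  X      : Fin n → Fin n → Tm n
  Q Q'   : Tm n
  𝟘 𝟙    : Tm n
  _⊕_ _⊗_ : Tm n → Tm n → Tm n
  ⊖_     : Tm n → Tm n

Δ : ∀ {n} → Tm n
Δ = Q ⊕ ⊖ Q'

infix 4 _≈_

data _≈_ {n : ℕ} : Tm n → Tm n → Set where
  ≈-refl  : ∀ {a} → a ≈ a
  ≈-sym   : ∀ {a b} → a ≈ b → b ≈ a
  ≈-trans : ∀ {a b c} → a ≈ b → b ≈ c → a ≈ c
  ⊕-cong  : ∀ {a b c d} → a ≈ b → c ≈ d → a ⊕ c ≈ b ⊕ d
  ⊗-cong  : ∀ {a b c d} → a ≈ b → c ≈ d → a ⊗ c ≈ b ⊗ d
  ⊖-cong  : ∀ {a b} → a ≈ b → ⊖ a ≈ ⊖ b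
  ⊕-assoc : ∀ a b c → (a ⊕ b) ⊕ c ≈ a ⊕ (b ⊕ c)
  ⊕-comm  : ∀ a b → a ⊕ b ≈ b ⊕ a
  ⊕-idˡ   : ∀ a → 𝟘 ⊕ a ≈ a
  ⊖-invˡ  : ∀ a → (⊖ a) ⊕ a ≈ 𝟘
  ⊗-assoc : ∀ a b c → (a ⊗ b) ⊗ c ≈ a ⊗ (b ⊗ c)
  ⊗-idˡ   : ∀ a → 𝟙 ⊗ a ≈ a
  ⊗-idʳ   : ∀ a → a ⊗ 𝟙 ≈ a
  distribˡ : ∀ a b c → a ⊗ (b ⊕ c) ≈ a ⊗ b ⊕ a ⊗ c
  distribʳ : ∀ a b c → (b ⊕ c) ⊗ a ≈ b ⊗ a ⊕ c ⊗ a
  Q-central : ∀ a → Q ⊗ a ≈ a ⊗ Q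
  Q-invʳ  : Q ⊗ Q' ≈ 𝟙
  Q-invˡ  : Q' ⊗ Q ≈ 𝟙
  rel₁ : ∀ {i k ℓ} → k Fin.< ℓ → X i ℓ ⊗ X i k ≈ Q ⊗ (X i k ⊗ X i ℓ)
  rel₂ : ∀ {i j k ℓ} → i Fin.< j → k Fin.< ℓ → X j k ⊗ X i ℓ ≈ X i ℓ ⊗ X j k
  rel₃ : ∀ {i j k} → i Fin.< j → X j k ⊗ X i k ≈ Q ⊗ (X i k ⊗ X j k)
  rel₄ : ∀ {i j k ℓ} → i Fin.< j → k Fin.< ℓ →
         X j ℓ ⊗ X i k ≈ X i k ⊗ X j ℓ ⊕ Δ ⊗ (X i ℓ ⊗ X j k)

natTm : ∀ {n} → ℕ → Tm n
natTm zero    = 𝟘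
natTm (suc c) = 𝟙 ⊕ natTm c

_^ₜ_ : ∀ {n} → Tm n → ℕ → Tm n
a ^ₜ zero  = 𝟙
a ^ₜ suc b = a ⊗ (a ^ₜ b)

sumTm : ∀ {n} → List (Tm n) → Tm n
sumTm = foldr _⊕_ 𝟘

xuv : ∀ {n} → Word n → Word n → Tm n
xuv u v = foldr _⊗_ 𝟙 (Vec.toList (Vec.zipWith X u v))

-- evaluation at q₁ = q^{1/2}-q^{-1/2} of the polynomial Σ_{b=0}^{k} c(b) q₁^b
polyAtΔ : ∀ {n} → ℕ → (ℕ → ℕ) → Tm n
polyAtΔ k c = sumTm (List.map (λ b → natTm (c b) ⊗ (Δ ^ₜ b)) (List.upTo (suc k)))

{-# OPTIONS --safe #-}
-- Length is the number of inversions, and π <B gen j · π exactly when π ascends at j, so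
-- the sets C^b are counted by a recursion along the word that branches at descents.  The
-- expansion follows by induction along the reduced expression: for u = s_j u′ with u′ again
-- length-additive over t, the relations of 𝒜 give x^{s_j u′, v} = x^{u′, s_j v} when v
-- ascends at j and x^{u′, s_j v} + q₁ x^{u′, v} when v descends at j, which is that recursion.
--
-- Independence of the reduced expression is proved combinatorially.  The counts along e arise
-- from the indicator of v by one "left step" operator per letter, and these commute with the
-- analogous "right step" operators (left and right multiplication in a Hecke-type algebra).
-- Along a reduced word starting at the identity no step can stay put, so two reduced
-- expressions of the same element agree on the identity, and right steps carry the agreement
-- to every v.
module Submission where

open import Defs
open import Data.Nat using (ℕ)
open import Data.Product using (Σ; _×_)
open import Data.List using (List; length; map)

open import Algebra.Bundles using (Ring)
open import Data.Empty using (⊥; ⊥-elim)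
open import Data.Fin as Fin using (Fin; zero; suc; inject₁; toℕ)
import Data.Fin.Properties as FinP
open import Data.List as L using ([]; _∷_; _++_)
import Data.List.Properties as LP
open import Data.List.Membership.Propositional using (_∈_)
open import Data.List.Membership.Propositional.Properties
  using (∈-map⁺; ∈-map⁻; ∈-++⁺ˡ; ∈-++⁺ʳ; ∈-++⁻; ∈-∃++; ∈-allFin)
open import Data.List.Relation.Binary.Sublist.Propositional using (⊆-refl; _∷ʳ_)
open import Data.List.Relation.Binary.Sublist.Heterogeneous.Properties using (length-mono-≤)
open import Data.List.Relation.Unary.All as All using (All; []; _∷_)
open import Data.List.Relation.Unary.AllPairs using ([]; _∷_)
open import Data.List.Relation.Unary.Any using (here; there; any?)
open import Data.List.Relation.Unary.Unique.Propositional using (Unique)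
import Data.List.Relation.Unary.Unique.Propositional.Properties as UniqueP
import Data.List.Relation.Unary.Unique.DecPropositional as UniqueD
open import Data.Nat as ℕ using (_+_; _≤_; _<_; z≤n; s≤s)
import Data.Nat.Properties as ℕP
open import Algebra.Properties.CommutativeSemigroup ℕP.+-commutativeSemigroup using (x∙yz≈y∙xz; interchange)
open import Data.Product as Product using (∃; Σ-syntax; _,_; proj₁; proj₂)
open import Data.Sum using (_⊎_; inj₁; inj₂)
open import Data.Vec as Vec using (Vec; []; _∷_; lookup; toList; _[_]≔_)
import Data.Vec.Properties as VecP
open import Data.Vec.Relation.Unary.Linked using (Linked; [-]; _∷_)
open import Function using (_∘_; id; flip)
open import Level using (0ℓ)
open import Relation.Binary using (Setoid; tri<; tri≈; tri>)
open import Relation.Binary.PropositionalEquality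
open import Relation.Nullary using (¬_; Dec; yes; no)
open import Relation.Nullary.Decidable using (_×-dec_; _⊎-dec_)

private
  variable
    A : Set
    m N k : ℕ

-- Adjacent transpositions

swap : Fin m → Vec A (ℕ.suc m) → Vec A (ℕ.suc m)
swap zero    (x ∷ y ∷ xs) = y ∷ x ∷ xs
swap (suc j) (x ∷ xs)     = x ∷ swap j xs

swap-involutive : ∀ (j : Fin m) (xs : Vec A (ℕ.suc m)) → swap j (swap j xs) ≡ xs
swap-involutive zero    (x ∷ y ∷ xs) = refl
swap-involutive (suc j) (x ∷ xs)     = cong (x ∷_) (swap-involutive j xs)

map-swap : ∀ {B : Set} (f : A → B) (j : Fin m) (xs : Vec A (ℕ.suc m)) →
           Vec.map f (swap j xs) ≡ swap j (Vec.map f xs)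
map-swap f zero    (x ∷ y ∷ xs) = refl
map-swap f (suc j) (x ∷ xs)     = cong (f x ∷_) (map-swap f j xs)

lookup-swap-inject₁ : ∀ (j : Fin m) (xs : Vec A (ℕ.suc m)) → lookup (swap j xs) (inject₁ j) ≡ lookup xs (suc j)
lookup-swap-inject₁ zero    (x ∷ y ∷ xs) = refl
lookup-swap-inject₁ (suc j) (x ∷ xs)     = lookup-swap-inject₁ j xs

lookup-swap-suc : ∀ (j : Fin m) (xs : Vec A (ℕ.suc m)) → lookup (swap j xs) (suc j) ≡ lookup xs (inject₁ j)
lookup-swap-suc zero    (x ∷ y ∷ xs) = refl
lookup-swap-suc (suc j) (x ∷ xs)     = lookup-swap-suc j xs

lookup-swap-other : ∀ (j : Fin m) (xs : Vec A (ℕ.suc m)) z → z ≢ inject₁ j → z ≢ suc j →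
                    lookup (swap j xs) z ≡ lookup xs z
lookup-swap-other zero    (x ∷ y ∷ xs) zero          z≢j _    = ⊥-elim (z≢j refl)
lookup-swap-other zero    (x ∷ y ∷ xs) (suc zero)    _   z≢j+1 = ⊥-elim (z≢j+1 refl)
lookup-swap-other zero    (x ∷ y ∷ xs) (suc (suc z)) _   _    = refl
lookup-swap-other (suc j) (x ∷ xs)     zero          _   _    = refl
lookup-swap-other (suc j) (x ∷ xs)     (suc z)       z≢j z≢j+1 =
  lookup-swap-other j xs z (z≢j ∘ cong suc) (z≢j+1 ∘ cong suc)

∈-swap⁻ : ∀ {z : A} (j : Fin m) (xs : Vec A (ℕ.suc m)) → z ∈ toList (swap j xs) → z ∈ toList xs
∈-swap⁻ zero    (x ∷ y ∷ xs) (here eq)         = there (here eq)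
∈-swap⁻ zero    (x ∷ y ∷ xs) (there (here eq)) = here eq
∈-swap⁻ zero    (x ∷ y ∷ xs) (there (there z∈)) = there (there z∈)
∈-swap⁻ (suc j) (x ∷ xs)     (here eq)         = here eq
∈-swap⁻ (suc j) (x ∷ xs)     (there z∈)        = there (∈-swap⁻ j xs z∈)

updateAt-swap : ∀ (j : Fin m) (xs : Vec A (ℕ.suc m)) →
  (xs [ inject₁ j ]≔ lookup xs (suc j)) [ suc j ]≔ lookup xs (inject₁ j) ≡ swap j xs
updateAt-swap zero    (x ∷ y ∷ xs) = refl
updateAt-swap (suc j) (x ∷ xs)     = cong (x ∷_) (updateAt-swap j xs)

gen≡swap-idW : ∀ (j : Fin m) → gen j ≡ swap j (idW (ℕ.suc m))
gen≡swap-idW {m} j =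
  trans (cong₂ (λ a b → (idW (ℕ.suc m) [ inject₁ j ]≔ a) [ suc j ]≔ b)
               (sym (VecP.lookup-allFin (suc j))) (sym (VecP.lookup-allFin (inject₁ j))))
        (updateAt-swap j (idW (ℕ.suc m)))

·-assoc : ∀ {n} (a b c : Word n) → (a · b) · c ≡ a · (b · c)
·-assoc a b c = trans (sym (VecP.map-∘ (lookup c) (lookup b) a))
                      (VecP.map-cong (λ i → sym (VecP.lookup-map i (lookup c) b)) a)

·-identityˡ : ∀ {n} (b : Word n) → idW n · b ≡ b
·-identityˡ = VecP.map-lookup-allFin

·-identityʳ : ∀ {n} (a : Word n) → a · idW n ≡ a
·-identityʳ a = trans (VecP.map-cong VecP.lookup-allFin a) (VecP.map-id a)

gen·≡swap : ∀ (j : Fin m) (w : Word (ℕ.suc m)) → gen j · w ≡ swap j w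
gen·≡swap {m} j w = begin
  Vec.map (lookup w) (gen j)                         ≡⟨ cong (Vec.map (lookup w)) (gen≡swap-idW j) ⟩
  Vec.map (lookup w) (swap j (idW (ℕ.suc m)))        ≡⟨ map-swap (lookup w) j (idW (ℕ.suc m)) ⟩
  swap j (idW (ℕ.suc m) · w)                         ≡⟨ cong (swap j) (·-identityˡ w) ⟩
  swap j w                                           ∎
  where open ≡-Reasoning

gen-involutive : ∀ (j : Fin m) (w : Word (ℕ.suc m)) → gen j · (gen j · w) ≡ w
gen-involutive j w = trans (gen·≡swap j (gen j · w))
                           (trans (cong (swap j) (gen·≡swap j w)) (swap-involutive j w))

gen·gen : ∀ (j : Fin m) → gen j · gen j ≡ idW (ℕ.suc m)
gen·gen {m} j = trans (cong (gen j ·_) (sym (·-identityʳ (gen j)))) (gen-involutive j (idW (ℕ.suc m)))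

·gen-involutive : ∀ (j : Fin m) (w : Word (ℕ.suc m)) → (w · gen j) · gen j ≡ w
·gen-involutive j w = trans (·-assoc w (gen j) (gen j)) (trans (cong (w ·_) (gen·gen j)) (·-identityʳ w))

eval-++ : ∀ {n} (e e′ : List (Gen n)) → eval (e ++ e′) ≡ eval e · eval e′
eval-++ []      e′ = sym (·-identityˡ (eval e′))
eval-++ (j ∷ e) e′ = trans (cong (gen j ·_) (eval-++ e e′)) (sym (·-assoc (gen j) (eval e) (eval e′)))

All-swap : ∀ {P : A → Set} (j : Fin m) (xs : Vec A (ℕ.suc m)) →
           All P (toList xs) → All P (toList (swap j xs))
All-swap zero    (x ∷ y ∷ xs) (px ∷ py ∷ pxs) = py ∷ px ∷ pxs
All-swap (suc j) (x ∷ xs)     (px ∷ pxs)      = px ∷ All-swap j xs pxs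

swap-unique : ∀ (j : Fin m) (xs : Vec A (ℕ.suc m)) → Unique (toList xs) → Unique (toList (swap j xs))
swap-unique zero    (x ∷ y ∷ xs) ((x≢y ∷ x∉xs) ∷ y∉xs ∷ u) = ((x≢y ∘ sym) ∷ y∉xs) ∷ x∉xs ∷ u
swap-unique (suc j) (x ∷ xs)     (x∉xs ∷ u)                 = All-swap j xs x∉xs ∷ swap-unique j xs u

All-lookup : ∀ {P : A → Set} (xs : Vec A k) → All P (toList xs) → ∀ i → P (lookup xs i)
All-lookup (x ∷ xs) (px ∷ _)   zero    = px
All-lookup (x ∷ xs) (_  ∷ pxs) (suc i) = All-lookup xs pxs i

lookup-injective : ∀ (xs : Vec A k) → Unique (toList xs) → ∀ i i′ → lookup xs i ≡ lookup xs i′ → i ≡ i′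
lookup-injective (x ∷ xs) u          zero    zero     eq = refl
lookup-injective (x ∷ xs) (x∉xs ∷ u) zero    (suc i′) eq = ⊥-elim (All-lookup xs x∉xs i′ eq)
lookup-injective (x ∷ xs) (x∉xs ∷ u) (suc i) zero     eq = ⊥-elim (All-lookup xs x∉xs i (sym eq))
lookup-injective (x ∷ xs) (_ ∷ u)    (suc i) (suc i′) eq = cong suc (lookup-injective xs u i i′ eq)

toList-tabulate : ∀ (f : Fin k → A) → toList (Vec.tabulate f) ≡ L.tabulate f
toList-tabulate {k = ℕ.zero}  f = refl
toList-tabulate {k = ℕ.suc k} f = cong (f zero ∷_) (toList-tabulate (f ∘ suc))

idW-isPerm : ∀ n → IsPerm (idW n)
idW-isPerm n = subst Unique (sym (toList-tabulate {k = n} id)) (UniqueP.allFin⁺ n)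

·-isPerm : ∀ {n} (a t : Word n) → IsPerm a → IsPerm t → IsPerm (a · t)
·-isPerm a t pa pt = subst Unique (sym (VecP.toList-map (lookup t) a))
                           (UniqueP.map⁺ (lookup-injective t pt _ _) pa)

map-injective : ∀ {B : Set} {f : A → B} → (∀ {x y} → f x ≡ f y → x ≡ y) →
                ∀ (xs ys : Vec A k) → Vec.map f xs ≡ Vec.map f ys → xs ≡ ys
map-injective f-inj []       []       eq = refl
map-injective f-inj (x ∷ xs) (y ∷ ys) eq =
  cong₂ _∷_ (f-inj (VecP.∷-injectiveˡ eq)) (map-injective f-inj xs ys (VecP.∷-injectiveʳ eq))

·-cancelʳ : ∀ {n} (a b t : Word n) → IsPerm t → a · t ≡ b · t → a ≡ b
·-cancelʳ a b t pt = map-injective (lookup-injective t pt _ _) a b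

gen·-isPerm : ∀ (j : Fin m) (w : Word (ℕ.suc m)) → IsPerm w → IsPerm (gen j · w)
gen·-isPerm j w pw = subst IsPerm (sym (gen·≡swap j w)) (swap-unique j w pw)

gen-isPerm : ∀ (j : Fin m) → IsPerm (gen j)
gen-isPerm {m} j = subst IsPerm (·-identityʳ (gen j)) (gen·-isPerm j (idW (ℕ.suc m)) (idW-isPerm (ℕ.suc m)))

eval-isPerm : ∀ {n} (e : List (Gen n)) → IsPerm (eval e)
eval-isPerm {n}       []      = idW-isPerm n
eval-isPerm {ℕ.suc m} (j ∷ e) = gen·-isPerm j (eval e) (eval-isPerm e)

-- Ascents, descents and inversions

Adjacent : (A → A → Set) → Fin m → Vec A (ℕ.suc m) → Set
Adjacent R j xs = R (lookup xs (inject₁ j)) (lookup xs (suc j))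

Ascent Descent : Fin m → Vec (Fin N) (ℕ.suc m) → Set
Ascent  = Adjacent Fin._<_
Descent = Adjacent (flip Fin._<_)

descent? : ∀ (j : Fin m) (xs : Vec (Fin N) (ℕ.suc m)) → Dec (Descent j xs)
descent? j xs = lookup xs (suc j) Fin.<? lookup xs (inject₁ j)

swap-adjacent : ∀ {R : A → A → Set} (j : Fin m) (xs : Vec A (ℕ.suc m)) →
                Adjacent R j xs → Adjacent (flip R) j (swap j xs)
swap-adjacent         zero    (x ∷ y ∷ xs) r = r
swap-adjacent {R = R} (suc j) (x ∷ xs)     r = swap-adjacent {R = R} j xs r

swap-adjacent⁻ : ∀ {R : A → A → Set} (j : Fin m) (xs : Vec A (ℕ.suc m)) →
                 Adjacent (flip R) j (swap j xs) → Adjacent R j xs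
swap-adjacent⁻         zero    (x ∷ y ∷ xs) r = r
swap-adjacent⁻ {R = R} (suc j) (x ∷ xs)     r = swap-adjacent⁻ {R = R} j xs r

inject₁≢suc : ∀ (j : Fin m) → inject₁ j ≢ suc j
inject₁≢suc j eq = ℕP.1+n≢n (sym (trans (sym (FinP.toℕ-inject₁ j)) (cong toℕ eq)))

ascent-or-descent : ∀ (j : Fin m) (xs : Vec (Fin N) (ℕ.suc m)) → Unique (toList xs) →
                    Ascent j xs ⊎ Descent j xs
ascent-or-descent j xs u with FinP.<-cmp (lookup xs (inject₁ j)) (lookup xs (suc j))
... | tri< a _ _ = inj₁ a
... | tri≈ _ e _ = ⊥-elim (inject₁≢suc j (lookup-injective xs u _ _ e))
... | tri> _ _ d = inj₂ d

¬ascent⇒descent : ∀ (j : Fin m) (xs : Vec (Fin N) (ℕ.suc m)) → Unique (toList xs) →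
                  ¬ Ascent j xs → Descent j xs
¬ascent⇒descent j xs u ¬a with ascent-or-descent j xs u
... | inj₁ a = ⊥-elim (¬a a)
... | inj₂ d = d

¬descent⇒ascent : ∀ (j : Fin m) (xs : Vec (Fin N) (ℕ.suc m)) → Unique (toList xs) →
                  ¬ Descent j xs → Ascent j xs
¬descent⇒ascent j xs u ¬d with ascent-or-descent j xs u
... | inj₁ a = a
... | inj₂ d = ⊥-elim (¬d d)

swap≢ : ∀ (j : Fin m) (xs : Vec (Fin N) (ℕ.suc m)) → Unique (toList xs) → swap j xs ≢ xs
swap≢ j xs u eq with ascent-or-descent j xs u
... | inj₁ a = FinP.<-asym a (subst (Descent j) eq (swap-adjacent {R = Fin._<_} j xs a))
... | inj₂ d = FinP.<-asym (subst (Ascent j) eq (swap-adjacent {R = flip Fin._<_} j xs d)) d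

when : ∀ {P : Set} → Dec P → ℕ → ℕ
when (yes _) x = x
when (no _)  _ = 0

when-yes : ∀ {P : Set} (d : Dec P) → P → ∀ x → when d x ≡ x
when-yes (yes _) _ x = refl
when-yes (no ¬p) p x = ⊥-elim (¬p p)

when-no : ∀ {P : Set} (d : Dec P) → ¬ P → ∀ x → when d x ≡ 0
when-no (yes p) ¬p x = ⊥-elim (¬p p)
when-no (no _)  _  x = refl

when-0 : ∀ {P : Set} (d : Dec P) → when d 0 ≡ 0
when-0 (yes _) = refl
when-0 (no _)  = refl

when-+ : ∀ {P : Set} (d : Dec P) x y → when d (x + y) ≡ when d x + when d y
when-+ (yes _) x y = refl
when-+ (no _)  x y = refl

when-interchange : ∀ {P Q : Set} (p : Dec P) (q : Dec Q) a b c →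
                   when p a + when q (b + when p c) ≡ when q b + when p (a + when q c)
when-interchange (yes _) (yes _) a b c = x∙yz≈y∙xz a b c
when-interchange (yes _) (no _)  a b c = refl
when-interchange (no _)  (yes _) a b c = refl
when-interchange (no _)  (no _)  a b c = refl

when-cong : ∀ {P Q : Set} (p : Dec P) (q : Dec Q) → (P → Q) → (Q → P) → ∀ x → when p x ≡ when q x
when-cong (yes _) (yes _) _ _ x = refl
when-cong (yes p) (no ¬q) f _ x = ⊥-elim (¬q (f p))
when-cong (no ¬p) (yes q) _ g x = ⊥-elim (¬p (g q))
when-cong (no _)  (no _)  _ _ x = refl

smaller : Fin N → Vec (Fin N) k → ℕ
smaller x []       = 0
smaller x (y ∷ ys) = when (y Fin.<? x) 1 + smaller x ys

inversions : Vec (Fin N) k → ℕ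
inversions []       = 0
inversions (x ∷ xs) = smaller x xs + inversions xs

smaller-swap : ∀ (x : Fin N) (j : Fin m) (ys : Vec (Fin N) (ℕ.suc m)) → smaller x (swap j ys) ≡ smaller x ys
smaller-swap x zero    (y ∷ y′ ∷ ys) = x∙yz≈y∙xz (when (y′ Fin.<? x) 1) (when (y Fin.<? x) 1) (smaller x ys)
smaller-swap x (suc j) (y ∷ ys)      = cong (when (y Fin.<? x) 1 +_) (smaller-swap x j ys)

inversions-swap-ascent : ∀ (j : Fin m) (xs : Vec (Fin N) (ℕ.suc m)) → Ascent j xs →
                         inversions (swap j xs) ≡ ℕ.suc (inversions xs)
inversions-swap-ascent zero (x ∷ y ∷ xs) x<y
  rewrite when-yes (x Fin.<? y) x<y 1 | when-no (y Fin.<? x) (FinP.<-asym x<y) 1 =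
  cong ℕ.suc (x∙yz≈y∙xz (smaller y xs) (smaller x xs) (inversions xs))
inversions-swap-ascent (suc j) (x ∷ xs) a =
  trans (cong₂ _+_ (smaller-swap x j xs) (inversions-swap-ascent j xs a)) (ℕP.+-suc (smaller x xs) (inversions xs))

inversions-swap-descent : ∀ (j : Fin m) (xs : Vec (Fin N) (ℕ.suc m)) → Descent j xs →
                          ℕ.suc (inversions (swap j xs)) ≡ inversions xs
inversions-swap-descent j xs d =
  trans (sym (inversions-swap-ascent j (swap j xs) (swap-adjacent {R = flip Fin._<_} j xs d)))
        (cong inversions (swap-involutive j xs))

inversions-swap-≤ : ∀ (j : Fin m) (xs : Vec (Fin N) (ℕ.suc m)) → Unique (toList xs) →
                    inversions (swap j xs) ≤ ℕ.suc (inversions xs)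
inversions-swap-≤ j xs u with ascent-or-descent j xs u
... | inj₁ a = ℕP.≤-reflexive (inversions-swap-ascent j xs a)
... | inj₂ d = ℕP.m≤n⇒m≤1+n (ℕP.≤-trans (ℕP.n≤1+n _) (ℕP.≤-reflexive (inversions-swap-descent j xs d)))

smaller-zero : ∀ (ys : Vec (Fin (ℕ.suc N)) k) → smaller zero ys ≡ 0
smaller-zero     []       = refl
smaller-zero {N} (y ∷ ys) = cong₂ _+_ (when-no (y Fin.<? zero {N}) ℕP.n≮0 1) (smaller-zero ys)

smaller-suc : ∀ (x : Fin N) (ys : Vec (Fin N) k) → smaller (suc x) (Vec.map suc ys) ≡ smaller x ys
smaller-suc x []       = refl
smaller-suc x (y ∷ ys) =
  cong₂ _+_ (when-cong (suc y Fin.<? suc x) (y Fin.<? x) ℕ.s<s⁻¹ ℕ.s<s 1) (smaller-suc x ys)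

inversions-map-suc : ∀ (xs : Vec (Fin N) k) → inversions (Vec.map suc xs) ≡ inversions xs
inversions-map-suc []       = refl
inversions-map-suc (x ∷ xs) = cong₂ _+_ (smaller-suc x xs) (inversions-map-suc xs)

inversions-idW : ∀ n → inversions (idW n) ≡ 0
inversions-idW ℕ.zero    = refl
inversions-idW (ℕ.suc n) = begin
  inversions (idW (ℕ.suc n))                                       ≡⟨ cong inversions (VecP.allFin-map n) ⟩
  smaller zero (Vec.map suc (idW n)) + inversions (Vec.map suc (idW n))
    ≡⟨ cong₂ _+_ (smaller-zero (Vec.map suc (idW n))) (inversions-map-suc (idW n)) ⟩
  inversions (idW n)                                               ≡⟨ inversions-idW n ⟩
  0                                                                ∎
  where open ≡-Reasoning

inversions-eval·-≤ : ∀ {n} (e : List (Gen n)) (x : Word n) → IsPerm x →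
                     inversions (eval e · x) ≤ length e + inversions x
inversions-eval·-≤ []                x px = ℕP.≤-reflexive (cong inversions (·-identityˡ x))
inversions-eval·-≤ {ℕ.suc m} (j ∷ e) x px = begin
  inversions (eval (j ∷ e) · x)     ≡⟨ cong inversions (trans (·-assoc (gen j) (eval e) x) (gen·≡swap j (eval e · x))) ⟩
  inversions (swap j (eval e · x))  ≤⟨ inversions-swap-≤ j (eval e · x) (·-isPerm (eval e) x (eval-isPerm e) px) ⟩
  ℕ.suc (inversions (eval e · x))   ≤⟨ s≤s (inversions-eval·-≤ e x px) ⟩
  ℕ.suc (length e + inversions x)   ∎
  where open ℕP.≤-Reasoning

inversions-eval-≤ : ∀ {n} (e : List (Gen n)) → inversions (eval e) ≤ length e
inversions-eval-≤ {n} e = begin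
  inversions (eval e)                ≡⟨ cong inversions (sym (·-identityʳ (eval e))) ⟩
  inversions (eval e · idW n)        ≤⟨ inversions-eval·-≤ e (idW n) (idW-isPerm n) ⟩
  length e + inversions (idW n)      ≡⟨ cong (length e +_) (inversions-idW n) ⟩
  length e + 0                       ≡⟨ ℕP.+-identityʳ (length e) ⟩
  length e                           ∎
  where open ℕP.≤-Reasoning

ascents⇒linked : ∀ (xs : Vec (Fin N) (ℕ.suc m)) → (∀ j → Ascent j xs) → Linked Fin._<_ xs
ascents⇒linked (x ∷ [])     _   = [-]
ascents⇒linked (x ∷ y ∷ xs) asc = asc zero ∷ ascents⇒linked (y ∷ xs) (asc ∘ suc)

linked-head-bound : ∀ (x : Fin N) (xs : Vec (Fin N) k) → Linked Fin._<_ (x ∷ xs) → k + ℕ.suc (toℕ x) ≤ N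
linked-head-bound x []       _           = FinP.toℕ<n x
linked-head-bound x (y ∷ xs) (x<y ∷ lxs) = begin
  ℕ.suc (k′ + ℕ.suc (toℕ x))  ≡⟨ sym (ℕP.+-suc k′ (ℕ.suc (toℕ x))) ⟩
  k′ + ℕ.suc (ℕ.suc (toℕ x))  ≤⟨ ℕP.+-monoʳ-≤ k′ (s≤s x<y) ⟩
  k′ + ℕ.suc (toℕ y)          ≤⟨ linked-head-bound y xs lxs ⟩
  _                           ∎
  where
  open ℕP.≤-Reasoning
  k′ = Vec.length xs

linked⇒lookup : ∀ (a : ℕ) (xs : Vec (Fin N) (ℕ.suc k)) → Linked Fin._<_ xs →
                a ≤ toℕ (Vec.head xs) → k + ℕ.suc a ≡ N → ∀ i → toℕ (lookup xs i) ≡ a + toℕ i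
linked⇒lookup {N = N} {k = k} a (x ∷ xs) lxs a≤x eq i = go xs lxs i
  where
  x≡a : toℕ x ≡ a
  x≡a = ℕP.≤-antisym (ℕP.≤-pred (ℕP.+-cancelˡ-≤ k _ _
          (ℕP.≤-trans (linked-head-bound x xs lxs) (ℕP.≤-reflexive (sym eq))))) a≤x
  go : ∀ (ys : Vec (Fin N) k) → Linked Fin._<_ (x ∷ ys) → ∀ i → toℕ (lookup (x ∷ ys) i) ≡ a + toℕ i
  go ys       _           zero    = trans x≡a (sym (ℕP.+-identityʳ a))
  go (y ∷ ys) (x<y ∷ lys) (suc i) =
    trans (linked⇒lookup (ℕ.suc a) (y ∷ ys) lys (subst (λ z → ℕ.suc z ≤ toℕ y) x≡a x<y)
                         (trans (ℕP.+-suc _ (ℕ.suc a)) eq) i)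
          (sym (ℕP.+-suc a (toℕ i)))

ascents⇒idW : ∀ (w : Word (ℕ.suc m)) → (∀ j → Ascent j w) → w ≡ idW (ℕ.suc m)
ascents⇒idW {m} w asc = trans (sym (VecP.tabulate∘lookup w)) (VecP.tabulate-cong λ i →
  FinP.toℕ-injective (linked⇒lookup 0 w (ascents⇒linked w asc) z≤n (ℕP.+-comm m 1) i))

-- Length and Bruhat order

-- Bubble sort: swapping a descent lowers the number of inversions by one.
expression-of-length-inversions : ∀ {n} (w : Word n) → IsPerm w →
             Σ[ e ∈ List (Gen n) ] eval e ≡ w × length e ≡ inversions w
expression-of-length-inversions {ℕ.zero}  [] _  = [] , refl , refl
expression-of-length-inversions {ℕ.suc m} w  pw = go (inversions w) w pw refl
  where
  go : ∀ k (w : Word (ℕ.suc m)) → IsPerm w → inversions w ≡ k →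
       Σ[ e ∈ List (Fin m) ] eval e ≡ w × length e ≡ inversions w
  go k w pw eq with FinP.any? (λ j → descent? j w)
  ... | no ¬d = [] , sym w≡id , sym (trans (cong inversions w≡id) (inversions-idW (ℕ.suc m)))
    where
    w≡id : w ≡ idW (ℕ.suc m)
    w≡id = ascents⇒idW w (λ j → ¬descent⇒ascent j w pw (λ d → ¬d (j , d)))
  go ℕ.zero    w pw eq | yes (j , d) = ⊥-elim (ℕP.0≢1+n (trans (sym eq) (sym (inversions-swap-descent j w d))))
  go (ℕ.suc k) w pw eq | yes (j , d) with go k (swap j w) (swap-unique j w pw)
                                            (ℕP.suc-injective (trans (inversions-swap-descent j w d) eq))
  ... | e , ev , len = j ∷ e , trans (gen·≡swap j (eval e)) (trans (cong (swap j) ev) (swap-involutive j w))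
                             , trans (cong ℕ.suc len) (inversions-swap-descent j w d)

reduced⇒length≡inversions : ∀ {n} (e : List (Gen n)) (g : Word n) → IsPerm g → Reduced e g →
                            length e ≡ inversions g
reduced⇒length≡inversions e g pg (ev , minimal) with expression-of-length-inversions g pg
... | e′ , ev′ , len′ = ℕP.≤-antisym (ℕP.≤-trans (minimal e′ ev′) (ℕP.≤-reflexive len′))
                                     (subst (λ h → inversions h ≤ length e) ev (inversions-eval-≤ e))

length≡inversions⇒reduced : ∀ {n} (e : List (Gen n)) (g : Word n) → eval e ≡ g → length e ≡ inversions g →
                            Reduced e g
length≡inversions⇒reduced e g ev len = ev , λ e′ ev′ →
  ℕP.≤-trans (ℕP.≤-reflexive len) (subst (λ h → inversions h ≤ length e′) ev′ (inversions-eval-≤ e′))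

ascent⇒<B : ∀ (j : Fin m) (π : Word (ℕ.suc m)) → IsPerm π → Ascent j π → π <B gen j · π
ascent⇒<B j π pπ a with expression-of-length-inversions π pπ
... | e , ev , len = (j ∷ e , e , reduced-j∷e , j ∷ʳ ⊆-refl , length≡inversions⇒reduced e π ev len) , π≢
  where
  reduced-j∷e : Reduced (j ∷ e) (gen j · π)
  reduced-j∷e = length≡inversions⇒reduced (j ∷ e) (gen j · π) (cong (gen j ·_) ev)
    (trans (cong ℕ.suc len) (sym (trans (cong inversions (gen·≡swap j π)) (inversions-swap-ascent j π a))))
  π≢ : π ≢ gen j · π
  π≢ eq = swap≢ j π pπ (sym (trans eq (gen·≡swap j π)))

descent⇒¬<B : ∀ (j : Fin m) (π : Word (ℕ.suc m)) → IsPerm π → Descent j π → ¬ (π <B gen j · π)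
descent⇒¬<B j π pπ d ((e , e′ , re , e′⊆e , re′) , _) = ℕP.<-irrefl refl (begin-strict
  inversions π                   ≡⟨ sym (reduced⇒length≡inversions e′ π pπ re′) ⟩
  length e′                      ≤⟨ length-mono-≤ e′⊆e ⟩
  length e                       ≡⟨ reduced⇒length≡inversions e (gen j · π) (gen·-isPerm j π pπ) re ⟩
  inversions (gen j · π)         ≡⟨ cong inversions (gen·≡swap j π) ⟩
  inversions (swap j π)          <⟨ ℕP.≤-reflexive (inversions-swap-descent j π d) ⟩
  inversions π                   ∎)
  where open ℕP.≤-Reasoning

¬<B⇒descent : ∀ (j : Fin m) (π : Word (ℕ.suc m)) → IsPerm π → ¬ (π <B gen j · π) → Descent j π
¬<B⇒descent j π pπ ¬< = ¬ascent⇒descent j π pπ (¬< ∘ ascent⇒<B j π pπ)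

-- The sets C^b and their sizes

_≟W_ : ∀ {n} (v w : Word n) → Dec (v ≡ w)
_≟W_ = VecP.≡-dec FinP._≟_

optional : ∀ {P : Set} → Dec P → List A → List A
optional (yes _) xs = xs
optional (no _)  _  = []

∈-optional⁺ : ∀ {P : Set} {x : A} {xs} (d : Dec P) → P → x ∈ xs → x ∈ optional d xs
∈-optional⁺ (yes _) _ x∈xs = x∈xs
∈-optional⁺ (no ¬p) p _    = ⊥-elim (¬p p)

∈-optional⁻ : ∀ {P : Set} {x : A} {xs} (d : Dec P) → x ∈ optional d xs → P × x ∈ xs
∈-optional⁻ (yes p) x∈xs = p , x∈xs

length-optional : ∀ {P : Set} (d : Dec P) (xs : List A) → length (optional d xs) ≡ when d (length xs)
length-optional (yes _) xs = refl
length-optional (no _)  xs = refl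

optional-unique : ∀ {P : Set} (d : Dec P) {xs : List A} → Unique xs → Unique (optional d xs)
optional-unique (yes _) u = u
optional-unique (no _)  _ = []

shift : A → (ℕ → A) → ℕ → A
shift z f ℕ.zero    = z
shift z f (ℕ.suc b) = f b

∈-shift-map-∷ : ∀ {x : A} {σ} (f : ℕ → List (List A)) b →
                σ ∈ shift [] (λ b′ → L.map (x ∷_) (f b′)) b → ∃ λ σ′ → σ ≡ x ∷ σ′
∈-shift-map-∷ {x = x} f (ℕ.suc b) σ∈ with ∈-map⁻ (x ∷_) σ∈
... | σ′ , _ , eq = σ′ , eq

-- An enumeration of the continuations counted by Steps; by ascent⇒<B and descent⇒¬<B
-- the Bruhat condition for staying put is exactly a descent of π at j.
paths : ∀ {n} → List (Gen n) → Word n → Word n → ℕ → List (List (Word n))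
paths []              π w ℕ.zero    = optional (π ≟W w) ([] ∷ [])
paths []              π w (ℕ.suc b) = []
paths {ℕ.suc m} (j ∷ e) π w b =
  L.map (gen j · π ∷_) (paths e (gen j · π) w b)
  ++ optional (descent? j π) (shift [] (λ b′ → L.map (π ∷_) (paths e π w b′)) b)

steps⇒∈paths : ∀ {n} (e : List (Gen n)) (π : Word n) (σ : List (Word n)) (w : Word n) (b : ℕ) →
               IsPerm π → Steps e π σ w b → σ ∈ paths e π w b
steps⇒∈paths [] π [] w ℕ.zero _ (refl , refl) = ∈-optional⁺ (π ≟W π) refl (here refl)
steps⇒∈paths {ℕ.suc m} (j ∷ e) π (_ ∷ σ) w b pπ (inj₁ (refl , st)) =
  ∈-++⁺ˡ (∈-map⁺ (gen j · π ∷_) (steps⇒∈paths e (gen j · π) σ w b (gen·-isPerm j π pπ) st))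
steps⇒∈paths {ℕ.suc m} (j ∷ e) π (_ ∷ σ) w _ pπ (inj₂ (refl , ¬< , b , refl , st)) =
  ∈-++⁺ʳ (L.map (gen j · π ∷_) (paths e (gen j · π) w (ℕ.suc b)))
         (∈-optional⁺ (descent? j π) (¬<B⇒descent j π pπ ¬<) (∈-map⁺ (π ∷_) (steps⇒∈paths e π σ w b pπ st)))

∈paths⇒steps : ∀ {n} (e : List (Gen n)) (π : Word n) (σ : List (Word n)) (w : Word n) (b : ℕ) →
               IsPerm π → σ ∈ paths e π w b → Steps e π σ w b
∈paths⇒steps [] π σ w ℕ.zero _ σ∈ with ∈-optional⁻ (π ≟W w) σ∈
... | π≡w , here refl = π≡w , refl
∈paths⇒steps {ℕ.suc m} (j ∷ e) π σ w b pπ σ∈ with ∈-++⁻ (L.map (gen j · π ∷_) (paths e (gen j · π) w b)) σ∈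
... | inj₁ σ∈up with ∈-map⁻ (gen j · π ∷_) σ∈up
...   | σ′ , σ′∈ , refl = inj₁ (refl , ∈paths⇒steps e (gen j · π) σ′ w b (gen·-isPerm j π pπ) σ′∈)
∈paths⇒steps {ℕ.suc m} (j ∷ e) π σ w (ℕ.suc b) pπ σ∈ | inj₂ σ∈stay
  with ∈-optional⁻ (descent? j π) σ∈stay
... | d , σ∈′ with ∈-map⁻ (π ∷_) σ∈′
...   | σ′ , σ′∈ , refl = inj₂ (refl , descent⇒¬<B j π pπ d , b , refl , ∈paths⇒steps e π σ′ w b pπ σ′∈)
∈paths⇒steps {ℕ.suc m} (j ∷ e) π σ w ℕ.zero pπ σ∈ | inj₂ σ∈stay with ∈-optional⁻ (descent? j π) σ∈stay
... | _ , ()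

paths-unique : ∀ {n} (e : List (Gen n)) (π w : Word n) (b : ℕ) → IsPerm π → Unique (paths e π w b)
paths-unique []      π w ℕ.zero    _  = optional-unique (π ≟W w) ([] ∷ [])
paths-unique []      π w (ℕ.suc b) _  = []
paths-unique {ℕ.suc m} (j ∷ e) π w b pπ =
  UniqueP.++⁺ (UniqueP.map⁺ LP.∷-injectiveʳ (paths-unique e (gen j · π) w b (gen·-isPerm j π pπ)))
              (optional-unique (descent? j π) (stays-unique b)) disjoint
  where
  stays-unique : ∀ b → Unique (shift [] (λ b′ → L.map (π ∷_) (paths e π w b′)) b)
  stays-unique ℕ.zero    = []
  stays-unique (ℕ.suc b) = UniqueP.map⁺ LP.∷-injectiveʳ (paths-unique e π w b pπ)
  disjoint : ∀ {σ} → ¬ (σ ∈ L.map (gen j · π ∷_) (paths e (gen j · π) w b)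
                       × σ ∈ optional (descent? j π) (shift [] (λ b′ → L.map (π ∷_) (paths e π w b′)) b))
  disjoint (σ∈up , σ∈stay) with ∈-map⁻ (gen j · π ∷_) σ∈up
  ... | _ , _ , refl with ∈-shift-map-∷ (paths e π w) b (proj₂ (∈-optional⁻ (descent? j π) σ∈stay))
  ...   | _ , eq = swap≢ j π pπ (trans (sym (gen·≡swap j π)) (LP.∷-injectiveˡ eq))

count : ∀ {n} → List (Gen n) → Word n → Word n → ℕ → ℕ
count e π w b = length (paths e π w b)

count-∷ : ∀ (j : Fin m) (e : List (Fin m)) (π w : Word (ℕ.suc m)) (b : ℕ) →
          count (j ∷ e) π w b ≡ count e (gen j · π) w b + when (descent? j π) (shift 0 (count e π w) b)
count-∷ j e π w b = trans (LP.length-++ (L.map (gen j · π ∷_) (paths e (gen j · π) w b)))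
  (cong₂ _+_ (LP.length-map (gen j · π ∷_) (paths e (gen j · π) w b))
             (trans (length-optional (descent? j π) _) (cong (when (descent? j π)) (length-stays b))))
  where
  length-stays : ∀ b → length (shift [] (λ b′ → L.map (π ∷_) (paths e π w b′)) b) ≡ shift 0 (count e π w) b
  length-stays ℕ.zero    = refl
  length-stays (ℕ.suc b) = LP.length-map (π ∷_) (paths e π w b)

count-vanishes : ∀ {n} (e : List (Gen n)) (π w : Word n) (b : ℕ) → length e < b → count e π w b ≡ 0
count-vanishes []      π w (ℕ.suc b) _ = refl
count-vanishes {ℕ.suc m} (j ∷ e) π w (ℕ.suc b) (s≤s e<b) = trans (count-∷ j e π w (ℕ.suc b))
  (cong₂ _+_ (count-vanishes e (gen j · π) w (ℕ.suc b) (ℕP.m≤n⇒m≤1+n e<b))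
             (trans (cong (when (descent? j π)) (count-vanishes e π w b e<b)) (when-0 (descent? j π))))

count-hasSize : ∀ {n} (e : List (Gen n)) (v w : Word n) (b : ℕ) → IsPerm v →
                HasSize (InC e v w b) (count e v w b)
count-hasSize e v w b pv = L.map (v ∷_) (paths e v w b)
                         , UniqueP.map⁺ LP.∷-injectiveʳ (paths-unique e v w b pv)
                         , LP.length-map (v ∷_) (paths e v w b)
                         , λ σ → InC⇒∈ σ , ∈⇒InC σ
  where
  InC⇒∈ : ∀ σ → InC e v w b σ → σ ∈ L.map (v ∷_) (paths e v w b)
  InC⇒∈ (_ ∷ σ) (refl , st) = ∈-map⁺ (v ∷_) (steps⇒∈paths e v σ w b pv st)
  ∈⇒InC : ∀ σ → σ ∈ L.map (v ∷_) (paths e v w b) → InC e v w b σ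
  ∈⇒InC σ σ∈ with ∈-map⁻ (v ∷_) σ∈
  ... | σ′ , σ′∈ , refl = refl , ∈paths⇒steps e v σ′ w b pv σ′∈

unique-⊆⇒length-≤ : ∀ (xs ys : List A) → Unique xs → (∀ {x} → x ∈ xs → x ∈ ys) → length xs ≤ length ys
unique-⊆⇒length-≤ []       ys _            _  = z≤n
unique-⊆⇒length-≤ (x ∷ xs) ys (x∉xs ∷ uxs) xs⊆ys with ∈-∃++ (xs⊆ys (here refl))
... | ys₁ , ys₂ , refl = begin
  ℕ.suc (length xs)          ≤⟨ s≤s (unique-⊆⇒length-≤ xs (ys₁ ++ ys₂) uxs xs⊆ys₁ys₂) ⟩
  ℕ.suc (length (ys₁ ++ ys₂)) ≡⟨ cong ℕ.suc (LP.length-++ ys₁) ⟩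
  ℕ.suc (length ys₁ + length ys₂) ≡⟨ sym (ℕP.+-suc (length ys₁) (length ys₂)) ⟩
  length ys₁ + length (x ∷ ys₂)   ≡⟨ sym (LP.length-++ ys₁) ⟩
  length (ys₁ ++ x ∷ ys₂)         ∎
  where
  open ℕP.≤-Reasoning
  xs⊆ys₁ys₂ : ∀ {z} → z ∈ xs → z ∈ ys₁ ++ ys₂
  xs⊆ys₁ys₂ z∈xs with ∈-++⁻ ys₁ (xs⊆ys (there z∈xs))
  ... | inj₁ z∈ys₁         = ∈-++⁺ˡ z∈ys₁
  ... | inj₂ (here refl)   = ⊥-elim (All.lookup x∉xs z∈xs refl)
  ... | inj₂ (there z∈ys₂) = ∈-++⁺ʳ ys₁ z∈ys₂

hasSize-unique : ∀ {P : A → Set} {s s′} → HasSize P s → HasSize P s′ → s ≡ s′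
hasSize-unique (xs , uxs , refl , xs≈P) (ys , uys , refl , ys≈P) =
  ℕP.≤-antisym (unique-⊆⇒length-≤ xs ys uxs λ {x} → proj₁ (ys≈P x) ∘ proj₂ (xs≈P x))
               (unique-⊆⇒length-≤ ys xs uys λ {x} → proj₁ (xs≈P x) ∘ proj₂ (ys≈P x))

-- Independence of the reduced expression

-- Right multiplication by gen j applies the transposition τ j of the letters j, j+1
-- to every letter: w · gen j = Vec.map (τ j) w holds by definition of _·_.
module _ {m : ℕ} (j : Fin m) where

  τ : Fin (ℕ.suc m) → Fin (ℕ.suc m)
  τ = lookup (gen j)

  private
    lookup-gen : ∀ z → τ z ≡ lookup (swap j (idW (ℕ.suc m))) z
    lookup-gen z = cong (λ v → lookup v z) (gen≡swap-idW j)

  τ-inject₁ : τ (inject₁ j) ≡ suc j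
  τ-inject₁ = trans (lookup-gen (inject₁ j)) (trans (lookup-swap-inject₁ j _) (VecP.lookup-allFin (suc j)))

  τ-suc : τ (suc j) ≡ inject₁ j
  τ-suc = trans (lookup-gen (suc j)) (trans (lookup-swap-suc j _) (VecP.lookup-allFin (inject₁ j)))

  τ-other : ∀ z → z ≢ inject₁ j → z ≢ suc j → τ z ≡ z
  τ-other z z≢j z≢j+1 = trans (lookup-gen z) (trans (lookup-swap-other j _ z z≢j z≢j+1) (VecP.lookup-allFin z))

  τ-involutive : ∀ z → τ (τ z) ≡ z
  τ-involutive z with z FinP.≟ inject₁ j | z FinP.≟ suc j
  ... | yes refl | _        = trans (cong τ τ-inject₁) τ-suc
  ... | no _     | yes refl = trans (cong τ τ-suc) τ-inject₁
  ... | no z≢j   | no z≢j+1 = trans (cong τ (τ-other z z≢j z≢j+1)) (τ-other z z≢j z≢j+1)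

  Pair : Fin (ℕ.suc m) → Fin (ℕ.suc m) → Set
  Pair x y = (x ≡ suc j × y ≡ inject₁ j) ⊎ (x ≡ inject₁ j × y ≡ suc j)

  pair? : ∀ x y → Dec (Pair x y)
  pair? x y = ((x FinP.≟ suc j) ×-dec (y FinP.≟ inject₁ j)) ⊎-dec ((x FinP.≟ inject₁ j) ×-dec (y FinP.≟ suc j))

  pair-sym : ∀ {x y} → Pair x y → Pair y x
  pair-sym (inj₁ (x≡ , y≡)) = inj₂ (y≡ , x≡)
  pair-sym (inj₂ (x≡ , y≡)) = inj₁ (y≡ , x≡)

  j<j+1 : inject₁ j Fin.< suc j
  j<j+1 = subst (ℕ._< ℕ.suc (toℕ j)) (sym (FinP.toℕ-inject₁ j)) (ℕP.n<1+n (toℕ j))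

  -- No letter lies strictly between j and j+1, so τ j preserves every comparison
  -- except the one between j and j+1 themselves.
  τ-mono : ∀ x y → y Fin.< x → ¬ Pair x y → τ y Fin.< τ x
  τ-mono x y y<x ¬pair with x FinP.≟ inject₁ j | x FinP.≟ suc j | y FinP.≟ inject₁ j | y FinP.≟ suc j
  ... | yes refl | _        | yes refl | _        = ⊥-elim (ℕP.<-irrefl refl y<x)
  ... | yes refl | _        | no _     | yes refl = ⊥-elim (FinP.<-asym y<x j<j+1)
  ... | yes refl | _        | no y≢j   | no y≢j+1 =
    subst₂ Fin._<_ (sym (τ-other y y≢j y≢j+1)) (sym τ-inject₁) (FinP.<-trans y<x j<j+1)
  ... | no _     | yes refl | yes refl | _        = ⊥-elim (¬pair (inj₁ (refl , refl)))
  ... | no _     | yes refl | no _     | yes refl = ⊥-elim (ℕP.<-irrefl refl y<x)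
  ... | no _     | yes refl | no y≢j   | no y≢j+1 =
    subst₂ Fin._<_ (sym (τ-other y y≢j y≢j+1)) (sym τ-suc)
      (subst (toℕ y ℕ.<_) (sym (FinP.toℕ-inject₁ j))
        (ℕP.≤∧≢⇒< (ℕP.≤-pred y<x) (y≢j ∘ FinP.toℕ-injective ∘ flip trans (sym (FinP.toℕ-inject₁ j)))))
  ... | no x≢j   | no x≢j+1 | yes refl | _        =
    subst₂ Fin._<_ (sym τ-inject₁) (sym (τ-other x x≢j x≢j+1))
      (ℕP.≤∧≢⇒< (subst (ℕ._< toℕ x) (FinP.toℕ-inject₁ j) y<x) (x≢j+1 ∘ FinP.toℕ-injective ∘ sym))
  ... | no x≢j   | no x≢j+1 | no _     | yes refl =
    subst₂ Fin._<_ (sym τ-suc) (sym (τ-other x x≢j x≢j+1)) (FinP.<-trans j<j+1 y<x)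
  ... | no x≢j   | no x≢j+1 | no y≢j   | no y≢j+1 =
    subst₂ Fin._<_ (sym (τ-other y y≢j y≢j+1)) (sym (τ-other x x≢j x≢j+1)) y<x

  τ-pair : ∀ x y → Pair (τ x) (τ y) → Pair x y
  τ-pair x y (inj₁ (τx≡ , τy≡)) = inj₂ ( trans (sym (τ-involutive x)) (trans (cong τ τx≡) τ-suc)
                                       , trans (sym (τ-involutive y)) (trans (cong τ τy≡) τ-inject₁))
  τ-pair x y (inj₂ (τx≡ , τy≡)) = inj₁ ( trans (sym (τ-involutive x)) (trans (cong τ τx≡) τ-inject₁)
                                       , trans (sym (τ-involutive y)) (trans (cong τ τy≡) τ-suc))

  τ-mono⁻ : ∀ x y → τ y Fin.< τ x → ¬ Pair x y → y Fin.< x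
  τ-mono⁻ x y τy<τx ¬pair =
    subst₂ Fin._<_ (τ-involutive y) (τ-involutive x) (τ-mono (τ x) (τ y) τy<τx (¬pair ∘ τ-pair x y))

  descent-·gen : ∀ (i : Fin k) (w : Vec (Fin (ℕ.suc m)) (ℕ.suc k)) → ¬ Adjacent Pair i w →
                 Descent i w → Descent i (Vec.map τ w)
  descent-·gen i w ¬pair d = subst₂ Fin._<_ (sym (VecP.lookup-map (suc i) τ w)) (sym (VecP.lookup-map (inject₁ i) τ w))
                                    (τ-mono _ _ d ¬pair)

  descent-·gen⁻ : ∀ (i : Fin k) (w : Vec (Fin (ℕ.suc m)) (ℕ.suc k)) → ¬ Adjacent Pair i w →
                  Descent i (Vec.map τ w) → Descent i w
  descent-·gen⁻ i w ¬pair d = τ-mono⁻ _ _ (subst₂ Fin._<_ (VecP.lookup-map (suc i) τ w) (VecP.lookup-map (inject₁ i) τ w) d)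
                                      ¬pair

  -- The right descents: RightDescent j w holds iff w · gen j < w.
  RightDescent : Vec (Fin (ℕ.suc m)) k → Set
  RightDescent []       = ⊥
  RightDescent (x ∷ xs) = (x ≡ suc j × inject₁ j ∈ toList xs) ⊎ RightDescent xs

  rightDescent? : ∀ (xs : Vec (Fin (ℕ.suc m)) k) → Dec (RightDescent xs)
  rightDescent? []       = no λ ()
  rightDescent? (x ∷ xs) = ((x FinP.≟ suc j) ×-dec any? (inject₁ j FinP.≟_) (toList xs)) ⊎-dec rightDescent? xs

  rightDescent⇒∈ : ∀ (xs : Vec (Fin (ℕ.suc m)) k) → RightDescent xs → suc j ∈ toList xs
  rightDescent⇒∈ (x ∷ xs) (inj₁ (refl , _)) = here refl
  rightDescent⇒∈ (x ∷ xs) (inj₂ rd)         = there (rightDescent⇒∈ xs rd)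

  pair⇒∈ : ∀ (i : Fin k) (w : Vec (Fin (ℕ.suc m)) (ℕ.suc k)) → Adjacent Pair i w →
           suc j ∈ toList w × inject₁ j ∈ toList w
  pair⇒∈ zero    (x ∷ y ∷ w) (inj₁ (refl , refl)) = here refl , there (here refl)
  pair⇒∈ zero    (x ∷ y ∷ w) (inj₂ (refl , refl)) = there (here refl) , here refl
  pair⇒∈ (suc i) (x ∷ w)     pair                 = Product.map there there (pair⇒∈ i w pair)

  swap-rightDescent⁻ : ∀ (i : Fin k) (w : Vec (Fin (ℕ.suc m)) (ℕ.suc k)) → ¬ Adjacent Pair i w →
                       RightDescent (swap i w) → RightDescent w
  swap-rightDescent⁻ zero    (x ∷ y ∷ w) ¬pair (inj₁ (refl , here refl))  = ⊥-elim (¬pair (inj₂ (refl , refl)))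
  swap-rightDescent⁻ zero    (x ∷ y ∷ w) ¬pair (inj₁ (refl , there j∈w)) = inj₂ (inj₁ (refl , j∈w))
  swap-rightDescent⁻ zero    (x ∷ y ∷ w) ¬pair (inj₂ (inj₁ (refl , j∈w))) = inj₁ (refl , there j∈w)
  swap-rightDescent⁻ zero    (x ∷ y ∷ w) ¬pair (inj₂ (inj₂ rd))           = inj₂ (inj₂ rd)
  swap-rightDescent⁻ (suc i) (x ∷ w)     ¬pair (inj₁ (refl , j∈w))        = inj₁ (refl , ∈-swap⁻ i w j∈w)
  swap-rightDescent⁻ (suc i) (x ∷ w)     ¬pair (inj₂ rd)                  = inj₂ (swap-rightDescent⁻ i w ¬pair rd)

  swap-rightDescent : ∀ (i : Fin k) (w : Vec (Fin (ℕ.suc m)) (ℕ.suc k)) → ¬ Adjacent Pair i w →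
                      RightDescent w → RightDescent (swap i w)
  swap-rightDescent i w ¬pair rd =
    swap-rightDescent⁻ i (swap i w) (¬pair ∘ pair-sym ∘ swap-adjacent⁻ {R = flip Pair} i w)
                       (subst RightDescent (sym (swap-involutive i w)) rd)

  pair⇒rightDescent⇔descent : ∀ (i : Fin k) (w : Vec (Fin (ℕ.suc m)) (ℕ.suc k)) → Unique (toList w) →
    Adjacent Pair i w → (RightDescent w → Descent i w) × (Descent i w → RightDescent w)
  pair⇒rightDescent⇔descent zero (x ∷ y ∷ w) _ (inj₁ (refl , refl)) = (λ _ → j<j+1) , (λ _ → inj₁ (refl , here refl))
  pair⇒rightDescent⇔descent zero (x ∷ y ∷ w) ((_ ∷ x∉w) ∷ y∉w ∷ _) (inj₂ (refl , refl)) =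
    rd⇒d , λ d → ⊥-elim (FinP.<-asym d j<j+1)
    where
    rd⇒d : RightDescent (x ∷ y ∷ w) → Descent zero (x ∷ y ∷ w)
    rd⇒d (inj₁ (eq , _))          = ⊥-elim (inject₁≢suc j eq)
    rd⇒d (inj₂ (inj₁ (_ , j∈w)))  = ⊥-elim (All.lookup x∉w j∈w refl)
    rd⇒d (inj₂ (inj₂ rd))         = ⊥-elim (All.lookup y∉w (rightDescent⇒∈ w rd) refl)
  pair⇒rightDescent⇔descent (suc i) (x ∷ w) (x∉w ∷ u) pair =
    Product.map rd⇒d (inj₂ ∘_) (pair⇒rightDescent⇔descent i w u pair)
    where
    rd⇒d : (RightDescent w → Descent i w) → RightDescent (x ∷ w) → Descent i w
    rd⇒d f (inj₁ (refl , _)) = ⊥-elim (All.lookup x∉w (proj₁ (pair⇒∈ i w pair)) refl)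
    rd⇒d f (inj₂ rd)         = f rd

  pair⇒swap≡·gen : ∀ (i : Fin k) (w : Vec (Fin (ℕ.suc m)) (ℕ.suc k)) → Unique (toList w) →
                   Adjacent Pair i w → swap i w ≡ Vec.map τ w
  pair⇒swap≡·gen zero (x ∷ y ∷ w) ((_ ∷ x∉w) ∷ y∉w ∷ _) pair =
    cong₂ _∷_ (sym (τ-fst pair)) (cong₂ _∷_ (sym (τ-snd pair)) (sym (map-fixed w (All.zipWith (fixed pair) (x∉w , y∉w)))))
    where
    τ-fst : Pair x y → τ x ≡ y
    τ-fst (inj₁ (refl , refl)) = τ-suc
    τ-fst (inj₂ (refl , refl)) = τ-inject₁
    τ-snd : Pair x y → τ y ≡ x
    τ-snd (inj₁ (refl , refl)) = τ-inject₁
    τ-snd (inj₂ (refl , refl)) = τ-suc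
    fixed : Pair x y → ∀ {z} → x ≢ z × y ≢ z → τ z ≡ z
    fixed (inj₁ (refl , refl)) {z} (x≢z , y≢z) = τ-other z (y≢z ∘ sym) (x≢z ∘ sym)
    fixed (inj₂ (refl , refl)) {z} (x≢z , y≢z) = τ-other z (x≢z ∘ sym) (y≢z ∘ sym)
    map-fixed : ∀ {k} (zs : Vec (Fin (ℕ.suc m)) k) → All (λ z → τ z ≡ z) (toList zs) → Vec.map τ zs ≡ zs
    map-fixed []       []         = refl
    map-fixed (z ∷ zs) (eq ∷ eqs) = cong₂ _∷_ eq (map-fixed zs eqs)
  pair⇒swap≡·gen (suc i) (x ∷ w) (x∉w ∷ u) pair = cong₂ _∷_ (sym τx≡x) (pair⇒swap≡·gen i w u pair)
    where
    τx≡x : τ x ≡ x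
    τx≡x = τ-other x (All.lookup x∉w (proj₂ (pair⇒∈ i w pair)))
                     (All.lookup x∉w (proj₁ (pair⇒∈ i w pair)))

-- Coefficient functions: f w b is the coefficient of q₁^b at the word w.
Coeffs : ℕ → Set
Coeffs n = Word n → ℕ → ℕ

infix 4 _≈ᶜ_
infixl 6 _⊞_

_≈ᶜ_ : ∀ {n} → Coeffs n → Coeffs n → Set
f ≈ᶜ g = ∀ w → IsPerm w → ∀ b → f w b ≡ g w b

_⊞_ : ∀ {n} → Coeffs n → Coeffs n → Coeffs n
(f ⊞ g) w b = f w b + g w b

𝟎 : ∀ {n} → Coeffs n
𝟎 w b = 0

raise : ∀ {n} → Coeffs n → Coeffs n
raise f w = shift 0 (f w)

gated : ∀ {n} {P : Set} → Dec P → Coeffs n → Coeffs n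
gated d f w b = when d (f w b)

δ : ∀ {n} → Word n → Coeffs n
δ = count []

leftStep : Fin m → Coeffs (ℕ.suc m) → Coeffs (ℕ.suc m)
leftStep i f w b = f (gen i · w) b + when (descent? i w) (raise f w b)

rightStep : Fin m → Coeffs (ℕ.suc m) → Coeffs (ℕ.suc m)
rightStep j f w b = f (w · gen j) b + when (rightDescent? j w) (raise f w b)

leftSteps : List (Fin m) → Coeffs (ℕ.suc m) → Coeffs (ℕ.suc m)
leftSteps []      f = f
leftSteps (i ∷ e) f = leftSteps e (leftStep i f)

raise-cong : ∀ {n} {f g : Coeffs n} → f ≈ᶜ g → raise f ≈ᶜ raise g
raise-cong f≈g w pw ℕ.zero    = refl
raise-cong f≈g w pw (ℕ.suc b) = f≈g w pw b

raise-⊞ : ∀ {n} (f g : Coeffs n) w b → raise (f ⊞ g) w b ≡ raise f w b + raise g w b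
raise-⊞ f g w ℕ.zero    = refl
raise-⊞ f g w (ℕ.suc b) = refl

leftStep-cong : ∀ i {f g : Coeffs (ℕ.suc m)} → f ≈ᶜ g → leftStep i f ≈ᶜ leftStep i g
leftStep-cong i f≈g w pw b =
  cong₂ _+_ (f≈g (gen i · w) (gen·-isPerm i w pw) b) (cong (when (descent? i w)) (raise-cong f≈g w pw b))

rightStep-cong : ∀ j {f g : Coeffs (ℕ.suc m)} → f ≈ᶜ g → rightStep j f ≈ᶜ rightStep j g
rightStep-cong j f≈g w pw b =
  cong₂ _+_ (f≈g (w · gen j) (·-isPerm w (gen j) pw (gen-isPerm j)) b)
            (cong (when (rightDescent? j w)) (raise-cong f≈g w pw b))

leftSteps-cong : ∀ e {f g : Coeffs (ℕ.suc m)} → f ≈ᶜ g → leftSteps e f ≈ᶜ leftSteps e g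
leftSteps-cong []      f≈g = f≈g
leftSteps-cong (i ∷ e) f≈g = leftSteps-cong e (leftStep-cong i f≈g)

leftStep-⊞ : ∀ i (f g : Coeffs (ℕ.suc m)) → leftStep i (f ⊞ g) ≈ᶜ leftStep i f ⊞ leftStep i g
leftStep-⊞ i f g w _ b =
  trans (cong (f (gen i · w) b + g (gen i · w) b +_)
              (trans (cong (when (descent? i w)) (raise-⊞ f g w b)) (when-+ (descent? i w) _ _)))
        (interchange (f (gen i · w) b) (g (gen i · w) b) _ _)

leftStep-raise : ∀ i (f : Coeffs (ℕ.suc m)) → leftStep i (raise f) ≈ᶜ raise (leftStep i f)
leftStep-raise i f w _ ℕ.zero    = when-0 (descent? i w)
leftStep-raise i f w _ (ℕ.suc b) = refl

leftStep-𝟎 : ∀ i → leftStep {m} i 𝟎 ≈ᶜ 𝟎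
leftStep-𝟎 i w _ ℕ.zero    = when-0 (descent? i w)
leftStep-𝟎 i w _ (ℕ.suc b) = when-0 (descent? i w)

leftSteps-⊞ : ∀ e (f g : Coeffs (ℕ.suc m)) → leftSteps e (f ⊞ g) ≈ᶜ leftSteps e f ⊞ leftSteps e g
leftSteps-⊞ []      f g w _  b = refl
leftSteps-⊞ (i ∷ e) f g w pw b =
  trans (leftSteps-cong e (leftStep-⊞ i f g) w pw b) (leftSteps-⊞ e (leftStep i f) (leftStep i g) w pw b)

leftSteps-raise : ∀ e (f : Coeffs (ℕ.suc m)) → leftSteps e (raise f) ≈ᶜ raise (leftSteps e f)
leftSteps-raise []      f w _  b = refl
leftSteps-raise (i ∷ e) f w pw b =
  trans (leftSteps-cong e (leftStep-raise i f) w pw b) (leftSteps-raise e (leftStep i f) w pw b)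

leftSteps-𝟎 : ∀ e → leftSteps {m} e 𝟎 ≈ᶜ 𝟎
leftSteps-𝟎 []      w _  b = refl
leftSteps-𝟎 (i ∷ e) w pw b = trans (leftSteps-cong e (leftStep-𝟎 i) w pw b) (leftSteps-𝟎 e w pw b)

leftSteps-gated : ∀ e {P : Set} (d : Dec P) (f : Coeffs (ℕ.suc m)) → leftSteps e (gated d f) ≈ᶜ gated d (leftSteps e f)
leftSteps-gated e (yes _) f w _  b = refl
leftSteps-gated e (no _)  f w pw b = leftSteps-𝟎 e w pw b

δ-zero : ∀ {n} (x w : Word n) → δ x w 0 ≡ when (x ≟W w) 1
δ-zero x w = length-optional (x ≟W w) ([] ∷ [])

δ-cong : ∀ {n} {x w x′ w′ : Word n} → (x ≡ w → x′ ≡ w′) → (x′ ≡ w′ → x ≡ w) → ∀ b → δ x w b ≡ δ x′ w′ b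
δ-cong {x = x} {w} {x′} {w′} f g ℕ.zero =
  trans (δ-zero x w) (trans (when-cong (x ≟W w) (x′ ≟W w′) f g 1) (sym (δ-zero x′ w′)))
δ-cong f g (ℕ.suc b) = refl

raise-δ-≢ : ∀ {n} {x w : Word n} → x ≢ w → ∀ b → raise (δ x) w b ≡ 0
raise-δ-≢         x≢w ℕ.zero            = refl
raise-δ-≢ {x = x} {w} x≢w (ℕ.suc ℕ.zero) = trans (δ-zero x w) (when-no (x ≟W w) x≢w 1)
raise-δ-≢         x≢w (ℕ.suc (ℕ.suc b)) = refl

-- raise (δ x) is supported at x, so a gate depending on the word may be evaluated at x.
gated-raise-δ : ∀ {n} {P : Word n → Set} (d : ∀ w → Dec (P w)) (x w : Word n) b →
                when (d w) (raise (δ x) w b) ≡ when (d x) (raise (δ x) w b)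
gated-raise-δ d x w b with x ≟W w
... | yes refl = refl
... | no x≢w   = trans (cong (when (d w)) (raise-δ-≢ x≢w b))
                       (trans (when-0 (d w)) (sym (trans (cong (when (d x)) (raise-δ-≢ x≢w b)) (when-0 (d x)))))

leftStep-δ : ∀ (j : Fin m) x → leftStep j (δ x) ≈ᶜ δ (gen j · x) ⊞ gated (descent? j x) (raise (δ x))
leftStep-δ j x w _ b =
  cong₂ _+_ (δ-cong (λ eq → trans (cong (gen j ·_) eq) (gen-involutive j w))
                    (λ eq → trans (sym (gen-involutive j x)) (cong (gen j ·_) eq)) b)
            (gated-raise-δ (descent? j) x w b)

rightStep-δ : ∀ (j : Fin m) x → rightStep j (δ x) ≈ᶜ δ (x · gen j) ⊞ gated (rightDescent? j x) (raise (δ x))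
rightStep-δ j x w _ b =
  cong₂ _+_ (δ-cong (λ eq → trans (cong (_· gen j) eq) (·gen-involutive j w))
                    (λ eq → trans (sym (·gen-involutive j x)) (cong (_· gen j) eq)) b)
            (gated-raise-δ (rightDescent? j) x w b)

count≈leftSteps-δ : ∀ (e : List (Fin m)) v → count e v ≈ᶜ leftSteps e (δ v)
count≈leftSteps-δ []      v w _  b = refl
count≈leftSteps-δ (j ∷ e) v w pw b = begin
  count (j ∷ e) v w b
    ≡⟨ count-∷ j e v w b ⟩
  count e (gen j · v) w b + when d (raise (count e v) w b)
    ≡⟨ cong₂ _+_ (count≈leftSteps-δ e (gen j · v) w pw b)
                 (cong (when d) (raise-cong (count≈leftSteps-δ e v) w pw b)) ⟩
  leftSteps e (δ (gen j · v)) w b + when d (raise (leftSteps e (δ v)) w b)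
    ≡⟨ cong (leftSteps e (δ (gen j · v)) w b +_)
            (sym (trans (leftSteps-gated e d (raise (δ v)) w pw b) (cong (when d) (leftSteps-raise e (δ v) w pw b)))) ⟩
  leftSteps e (δ (gen j · v)) w b + leftSteps e (gated d (raise (δ v))) w b
    ≡⟨ sym (leftSteps-⊞ e (δ (gen j · v)) (gated d (raise (δ v))) w pw b) ⟩
  leftSteps e (δ (gen j · v) ⊞ gated d (raise (δ v))) w b
    ≡⟨ sym (leftSteps-cong e (leftStep-δ j v) w pw b) ⟩
  leftSteps e (leftStep j (δ v)) w b ∎
  where
  open ≡-Reasoning
  d = descent? j v

-- If the letters j, j+1 sit at
-- positions i, i+1 of w then gen i · w = w · gen j and both gates are governed by the
-- descent of w at i; otherwise each gate is unchanged by the step on the other side.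
leftStep-rightStep-gates : ∀ (i j : Fin m) (f : Coeffs (ℕ.suc m)) w → IsPerm w → ∀ b →
  when (rightDescent? j (gen i · w)) (f (gen i · w) b)
    + when (descent? i w) (f (w · gen j) b + when (rightDescent? j w) (raise f w b))
  ≡ when (descent? i (w · gen j)) (f (w · gen j) b)
    + when (rightDescent? j w) (f (gen i · w) b + when (descent? i w) (raise f w b))
leftStep-rightStep-gates i j f w pw b with pair? j (lookup w (inject₁ i)) (lookup w (suc i))
... | yes pair = begin
  when R′ fᵢ + when D (fⱼ + when R f₀)  ≡⟨ cong₂ _+_ (trans (when-cong R′ D′ (proj₁ R′⇔D′) (proj₂ R′⇔D′) fᵢ) (cong (when D′) fᵢ≡fⱼ))
                                                  (cong (when D) (cong₂ _+_ (sym fᵢ≡fⱼ) (when-cong R D (proj₁ R⇔D) (proj₂ R⇔D) f₀))) ⟩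
  when D′ fⱼ + when D (fᵢ + when D f₀)  ≡⟨ cong (when D′ fⱼ +_) (when-cong D R (proj₂ R⇔D) (proj₁ R⇔D) _) ⟩
  when D′ fⱼ + when R (fᵢ + when D f₀)  ∎
  where
  open ≡-Reasoning
  R′ = rightDescent? j (gen i · w); R = rightDescent? j w; D′ = descent? i (w · gen j); D = descent? i w
  fᵢ = f (gen i · w) b; fⱼ = f (w · gen j) b; f₀ = raise f w b
  swap≡·gen : swap i w ≡ w · gen j
  swap≡·gen = pair⇒swap≡·gen j i w pw pair
  fᵢ≡fⱼ : fᵢ ≡ fⱼ
  fᵢ≡fⱼ = cong (λ x → f x b) (trans (gen·≡swap i w) swap≡·gen)
  R⇔D : (RightDescent j w → Descent i w) × (Descent i w → RightDescent j w)
  R⇔D = pair⇒rightDescent⇔descent j i w pw pair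
  R′⇔D′ : (RightDescent j (gen i · w) → Descent i (w · gen j)) × (Descent i (w · gen j) → RightDescent j (gen i · w))
  R′⇔D′ = subst₂ (λ u v → (RightDescent j u → Descent i v) × (Descent i v → RightDescent j u))
                 (sym (gen·≡swap i w)) swap≡·gen
                 (pair⇒rightDescent⇔descent j i (swap i w) (swap-unique i w pw)
                    (swap-adjacent {R = flip (Pair j)} i w (pair-sym j pair)))
... | no ¬pair = begin
  when R′ fᵢ + when D (fⱼ + when R f₀)  ≡⟨ cong (_+ when D (fⱼ + when R f₀)) (when-cong R′ R R′⇒R R⇒R′ fᵢ) ⟩
  when R fᵢ + when D (fⱼ + when R f₀)   ≡⟨ when-interchange R D fᵢ fⱼ f₀ ⟩
  when D fⱼ + when R (fᵢ + when D f₀)   ≡⟨ cong (_+ when R (fᵢ + when D f₀))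
                                             (when-cong D D′ (descent-·gen j i w ¬pair) (descent-·gen⁻ j i w ¬pair) fⱼ) ⟩
  when D′ fⱼ + when R (fᵢ + when D f₀)  ∎
  where
  open ≡-Reasoning
  R′ = rightDescent? j (gen i · w); R = rightDescent? j w; D′ = descent? i (w · gen j); D = descent? i w
  fᵢ = f (gen i · w) b; fⱼ = f (w · gen j) b; f₀ = raise f w b
  R′⇒R : RightDescent j (gen i · w) → RightDescent j w
  R′⇒R = swap-rightDescent⁻ j i w ¬pair ∘ subst (RightDescent j) (gen·≡swap i w)
  R⇒R′ : RightDescent j w → RightDescent j (gen i · w)
  R⇒R′ = subst (RightDescent j) (sym (gen·≡swap i w)) ∘ swap-rightDescent j i w ¬pair

leftStep-rightStep : ∀ (i j : Fin m) f → leftStep i (rightStep j f) ≈ᶜ rightStep j (leftStep i f)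
leftStep-rightStep i j f w pw ℕ.zero =
  cong₂ _+_ (cong₂ _+_ (cong (λ x → f x 0) (·-assoc (gen i) w (gen j)))
                       (trans (when-0 (rightDescent? j (gen i · w))) (sym (when-0 (descent? i (w · gen j))))))
            (trans (when-0 (descent? i w)) (sym (when-0 (rightDescent? j w))))
leftStep-rightStep i j f w pw (ℕ.suc b) = begin
  f ((gen i · w) · gen j) (ℕ.suc b) + X₁ + X₂   ≡⟨ ℕP.+-assoc _ X₁ X₂ ⟩
  f ((gen i · w) · gen j) (ℕ.suc b) + (X₁ + X₂) ≡⟨ cong₂ _+_ (cong (λ x → f x (ℕ.suc b)) (·-assoc (gen i) w (gen j)))
                                                            (leftStep-rightStep-gates i j f w pw b) ⟩
  f (gen i · (w · gen j)) (ℕ.suc b) + (Y₁ + Y₂) ≡⟨ sym (ℕP.+-assoc _ Y₁ Y₂) ⟩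
  f (gen i · (w · gen j)) (ℕ.suc b) + Y₁ + Y₂   ∎
  where
  open ≡-Reasoning
  X₁ = when (rightDescent? j (gen i · w)) (f (gen i · w) b)
  X₂ = when (descent? i w) (f (w · gen j) b + when (rightDescent? j w) (raise f w b))
  Y₁ = when (descent? i (w · gen j)) (f (w · gen j) b)
  Y₂ = when (rightDescent? j w) (f (gen i · w) b + when (descent? i w) (raise f w b))

leftSteps-rightStep : ∀ e (j : Fin m) f → leftSteps e (rightStep j f) ≈ᶜ rightStep j (leftSteps e f)
leftSteps-rightStep []      j f w _  b = refl
leftSteps-rightStep (i ∷ e) j f w pw b =
  trans (leftSteps-cong e (leftStep-rightStep i j f) w pw b) (leftSteps-rightStep e j (leftStep i f) w pw b)

-- walk e x is the end of the path from x along e that never stays put.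
walk : List (Fin m) → Word (ℕ.suc m) → Word (ℕ.suc m)
walk []      x = x
walk (j ∷ e) x = walk e (gen j · x)

walk-isPerm : ∀ (e : List (Fin m)) x → IsPerm x → IsPerm (walk e x)
walk-isPerm []      x px = px
walk-isPerm (j ∷ e) x px = walk-isPerm e (gen j · x) (gen·-isPerm j x px)

inversions-walk-≤ : ∀ (e : List (Fin m)) x → IsPerm x → inversions (walk e x) ≤ length e + inversions x
inversions-walk-≤ []      x px = ℕP.≤-refl
inversions-walk-≤ (j ∷ e) x px = begin
  inversions (walk e (gen j · x))        ≤⟨ inversions-walk-≤ e (gen j · x) (gen·-isPerm j x px) ⟩
  length e + inversions (gen j · x)      ≡⟨ cong (λ y → length e + inversions y) (gen·≡swap j x) ⟩
  length e + inversions (swap j x)       ≤⟨ ℕP.+-monoʳ-≤ (length e) (inversions-swap-≤ j x px) ⟩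
  length e + ℕ.suc (inversions x)        ≡⟨ ℕP.+-suc (length e) (inversions x) ⟩
  ℕ.suc (length e + inversions x)        ∎
  where open ℕP.≤-Reasoning

walk-eval· : ∀ (e : List (Fin m)) z → walk e (eval e · z) ≡ z
walk-eval· []      z = ·-identityˡ z
walk-eval· (j ∷ e) z = trans (cong (walk e) (trans (cong (gen j ·_) (·-assoc (gen j) (eval e) z))
                                                   (gen-involutive j (eval e · z))))
                             (walk-eval· e z)

walk-· : ∀ (e : List (Fin m)) a x → walk e (a · x) ≡ walk e a · x
walk-· []      a x = refl
walk-· (j ∷ e) a x = trans (cong (walk e) (sym (·-assoc (gen j) a x))) (walk-· e (gen j · a) x)

walk-idW·eval : ∀ (e : List (Fin m)) → walk e (idW (ℕ.suc m)) · eval e ≡ idW (ℕ.suc m)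
walk-idW·eval {m} e = begin
  walk e (idW (ℕ.suc m)) · eval e      ≡⟨ sym (walk-· e (idW (ℕ.suc m)) (eval e)) ⟩
  walk e (idW (ℕ.suc m) · eval e)      ≡⟨ cong (walk e) (trans (·-identityˡ (eval e)) (sym (·-identityʳ (eval e)))) ⟩
  walk e (eval e · idW (ℕ.suc m))      ≡⟨ walk-eval· e (idW (ℕ.suc m)) ⟩
  idW (ℕ.suc m)                        ∎
  where open ≡-Reasoning

walk≡eval-reverse : ∀ (e : List (Fin m)) x → walk e x ≡ eval (L.reverse e) · x
walk≡eval-reverse []      x = sym (·-identityˡ x)
walk≡eval-reverse {m} (j ∷ e) x = begin
  walk e (gen j · x)                                   ≡⟨ walk≡eval-reverse e (gen j · x) ⟩
  eval (L.reverse e) · (gen j · x)                     ≡⟨ cong (λ y → eval (L.reverse e) · (y · x)) (sym (·-identityʳ (gen j))) ⟩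
  eval (L.reverse e) · (eval (j ∷ []) · x)             ≡⟨ sym (·-assoc (eval (L.reverse e)) (eval (j ∷ [])) x) ⟩
  (eval (L.reverse e) · eval (j ∷ [])) · x             ≡⟨ cong (_· x) (sym (eval-++ (L.reverse e) (j ∷ []))) ⟩
  eval (L.reverse e ++ j ∷ []) · x                     ≡⟨ cong (λ e′ → eval e′ · x) (sym (LP.unfold-reverse j e)) ⟩
  eval (L.reverse (j ∷ e)) · x                         ∎
  where open ≡-Reasoning

-- Along a walk that gains an inversion at every step, no step can stay put.
leftSteps-δ : ∀ (e : List (Fin m)) x → IsPerm x → inversions (walk e x) ≡ length e + inversions x →
              leftSteps e (δ x) ≈ᶜ δ (walk e x)
leftSteps-δ []      x px eq w _ b = refl
leftSteps-δ (j ∷ e) x px eq with descent? j x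
... | yes d = ⊥-elim (ℕP.<-irrefl refl (begin-strict
  ℕ.suc (length e + inversions x)    ≡⟨ sym eq ⟩
  inversions (walk e (gen j · x))    ≤⟨ inversions-walk-≤ e (gen j · x) (gen·-isPerm j x px) ⟩
  length e + inversions (gen j · x)  <⟨ ℕP.+-monoʳ-< (length e) (ℕP.≤-reflexive
                                         (trans (cong (ℕ.suc ∘ inversions) (gen·≡swap j x)) (inversions-swap-descent j x d))) ⟩
  length e + inversions x            <⟨ ℕP.n<1+n _ ⟩
  ℕ.suc (length e + inversions x)    ∎))
  where open ℕP.≤-Reasoning
... | no ¬d = λ w pw b →
  trans (leftSteps-cong e (λ w pw b → trans (leftStep-δ j x w pw b)
                                              (trans (cong (δ (gen j · x) w b +_) (when-no (descent? j x) ¬d _))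
                                                     (ℕP.+-identityʳ _))) w pw b)
        (leftSteps-δ e (gen j · x) (gen·-isPerm j x px) eq′ w pw b)
  where
  eq′ : inversions (walk e (gen j · x)) ≡ length e + inversions (gen j · x)
  eq′ = trans eq (trans (sym (ℕP.+-suc (length e) (inversions x)))
                        (cong (length e +_) (sym (trans (cong inversions (gen·≡swap j x))
                                                        (inversions-swap-ascent j x (¬descent⇒ascent j x px ¬d))))))

reduced⇒inversions-walk : ∀ (e : List (Fin m)) → Reduced e (eval e) → inversions (walk e (idW (ℕ.suc m))) ≡ length e
reduced⇒inversions-walk {m} e (_ , minimal) = ℕP.≤-antisym upper lower
  where
  I = idW (ℕ.suc m)
  upper : inversions (walk e I) ≤ length e
  upper = ℕP.≤-trans (inversions-walk-≤ e I (idW-isPerm (ℕ.suc m)))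
                     (ℕP.≤-reflexive (trans (cong (length e +_) (inversions-idW (ℕ.suc m))) (ℕP.+-identityʳ (length e))))
  -- Reversing an expression of walk e I gives an expression of eval e.
  lower : length e ≤ inversions (walk e I)
  lower with expression-of-length-inversions (walk e I) (walk-isPerm e I (idW-isPerm (ℕ.suc m)))
  ... | g , evg , lg = ℕP.≤-trans (minimal (L.reverse g) eval-reverse-g) (ℕP.≤-reflexive (trans (LP.length-reverse g) lg))
    where
    eval-reverse-g : eval (L.reverse g) ≡ eval e
    eval-reverse-g = begin
      eval (L.reverse g)              ≡⟨ sym (·-identityʳ (eval (L.reverse g))) ⟩
      eval (L.reverse g) · I          ≡⟨ sym (walk≡eval-reverse g I) ⟩
      walk g I                        ≡⟨ cong (walk g) (sym (walk-idW·eval e)) ⟩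
      walk g (walk e I · eval e)      ≡⟨ cong (λ y → walk g (y · eval e)) (sym evg) ⟩
      walk g (eval g · eval e)        ≡⟨ walk-eval· g (eval e) ⟩
      eval e                          ∎
      where open ≡-Reasoning

module _ (e e′ : List (Fin m)) where

  Agree : Coeffs (ℕ.suc m) → Set
  Agree h = leftSteps e h ≈ᶜ leftSteps e′ h

  agree-resp : ∀ {h h′} → h ≈ᶜ h′ → Agree h → Agree h′
  agree-resp h≈h′ agree w pw b =
    trans (sym (leftSteps-cong e h≈h′ w pw b)) (trans (agree w pw b) (leftSteps-cong e′ h≈h′ w pw b))

  agree-rightStep : ∀ j {h} → Agree h → Agree (rightStep j h)
  agree-rightStep j {h} agree w pw b =
    trans (leftSteps-rightStep e j h w pw b)
          (trans (rightStep-cong j agree w pw b) (sym (leftSteps-rightStep e′ j h w pw b)))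

  agree-gated-raise : ∀ {P : Set} (d : Dec P) {h} → Agree h → Agree (gated d (raise h))
  agree-gated-raise (yes _) {h} agree w pw b =
    trans (leftSteps-raise e h w pw b) (trans (raise-cong agree w pw b) (sym (leftSteps-raise e′ h w pw b)))
  agree-gated-raise (no _) agree w pw b = trans (leftSteps-𝟎 e w pw b) (sym (leftSteps-𝟎 e′ w pw b))

  agree-cancelʳ : ∀ {h₁ h₂} → Agree (h₁ ⊞ h₂) → Agree h₂ → Agree h₁
  agree-cancelʳ {h₁} {h₂} agree₁₂ agree₂ w pw b = ℕP.+-cancelʳ-≡ (leftSteps e′ h₂ w b) _ _ (begin
    leftSteps e h₁ w b + leftSteps e′ h₂ w b  ≡⟨ cong (leftSteps e h₁ w b +_) (sym (agree₂ w pw b)) ⟩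
    leftSteps e h₁ w b + leftSteps e h₂ w b   ≡⟨ sym (leftSteps-⊞ e h₁ h₂ w pw b) ⟩
    leftSteps e (h₁ ⊞ h₂) w b                 ≡⟨ agree₁₂ w pw b ⟩
    leftSteps e′ (h₁ ⊞ h₂) w b                ≡⟨ leftSteps-⊞ e′ h₁ h₂ w pw b ⟩
    leftSteps e′ h₁ w b + leftSteps e′ h₂ w b ∎)
    where open ≡-Reasoning

  -- rightStep j (δ x) is δ (x · gen j) plus a gated multiple of δ x, and both rightStep and
  -- gated multiples preserve Agree.
  agree-δ-·gen : ∀ j x → Agree (δ x) → Agree (δ (x · gen j))
  agree-δ-·gen j x agree =
    agree-cancelʳ (agree-resp (rightStep-δ j x) (agree-rightStep j agree)) (agree-gated-raise (rightDescent? j x) agree)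

  agree-δ-·eval : ∀ (f : List (Fin m)) x → Agree (δ x) → Agree (δ (x · eval f))
  agree-δ-·eval []      x agree = subst (Agree ∘ δ) (sym (·-identityʳ x)) agree
  agree-δ-·eval (j ∷ f) x agree =
    subst (Agree ∘ δ) (·-assoc x (gen j) (eval f)) (agree-δ-·eval f (x · gen j) (agree-δ-·gen j x agree))

count-independent : ∀ {n} (e e′ : List (Gen n)) → Reduced e (eval e) → Reduced e′ (eval e′) → eval e ≡ eval e′ →
                    ∀ v → IsPerm v → count e v ≈ᶜ count e′ v
count-independent {ℕ.zero}  []  []  _  _   _  v pv w pw b = refl
count-independent {ℕ.suc m} e e′ re re′ ee v pv w pw b = begin
  count e v w b              ≡⟨ count≈leftSteps-δ e v w pw b ⟩
  leftSteps e (δ v) w b      ≡⟨ agree-v w pw b ⟩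
  leftSteps e′ (δ v) w b     ≡⟨ sym (count≈leftSteps-δ e′ v w pw b) ⟩
  count e′ v w b             ∎
  where
  open ≡-Reasoning
  I = idW (ℕ.suc m)
  walk≡walk : walk e I ≡ walk e′ I
  walk≡walk = ·-cancelʳ (walk e I) (walk e′ I) (eval e) (eval-isPerm e)
    (trans (walk-idW·eval e) (sym (trans (cong (walk e′ I ·_) ee) (walk-idW·eval e′))))
  leftSteps-δI : ∀ f → Reduced f (eval f) → leftSteps f (δ I) ≈ᶜ δ (walk f I)
  leftSteps-δI f rf = leftSteps-δ f I (idW-isPerm (ℕ.suc m))
    (trans (reduced⇒inversions-walk f rf) (sym (trans (cong (length f +_) (inversions-idW (ℕ.suc m))) (ℕP.+-identityʳ _))))
  agree-I : Agree e e′ (δ I)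
  agree-I w pw b = trans (leftSteps-δI e re w pw b)
                         (trans (cong (λ y → δ y w b) walk≡walk) (sym (leftSteps-δI e′ re′ w pw b)))
  agree-v : Agree e e′ (δ v)
  agree-v with expression-of-length-inversions v pv
  ... | f , evf , _ = subst (Agree e e′ ∘ δ) (trans (·-identityˡ (eval f)) evf) (agree-δ-·eval e e′ f I agree-I)

-- The quantum matrix bialgebra

𝒜-setoid : ℕ → Setoid 0ℓ 0ℓ
𝒜-setoid n = record
  { Carrier       = Tm n
  ; _≈_           = _≈_
  ; isEquivalence = record { refl = ≈-refl ; sym = ≈-sym ; trans = ≈-trans }
  }

𝒜 : ℕ → Ring 0ℓ 0ℓ
𝒜 n = record
  { Carrier = Tm n ; _≈_ = _≈_ ; _+_ = _⊕_ ; _*_ = _⊗_ ; -_ = ⊖_ ; 0# = 𝟘 ; 1# = 𝟙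
  ; isRing = record
    { +-isAbelianGroup = record
      { isGroup = record
        { isMonoid = record
          { isSemigroup = record
            { isMagma = record { isEquivalence = Setoid.isEquivalence (𝒜-setoid n) ; ∙-cong = ⊕-cong }
            ; assoc   = ⊕-assoc }
          ; identity = ⊕-idˡ , comm∧idˡ⇒idʳ ⊕-comm ⊕-idˡ }
        ; inverse = ⊖-invˡ , comm∧invˡ⇒invʳ ⊕-comm ⊖-invˡ
        ; ⁻¹-cong = ⊖-cong }
      ; comm = ⊕-comm }
    ; *-cong     = ⊗-cong
    ; *-assoc    = ⊗-assoc
    ; *-identity = ⊗-idˡ , ⊗-idʳ
    ; distrib    = distribˡ , distribʳ
    }
  }
  where open import Algebra.Consequences.Setoid (𝒜-setoid n) using (comm∧idˡ⇒idʳ; comm∧invˡ⇒invʳ)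

module _ {n : ℕ} where
  open Ring (𝒜 n) using (+-identityʳ; zeroˡ; zeroʳ; +-commutativeSemigroup)
  open import Algebra.Properties.Ring (𝒜 n) using (-‿distribˡ-*; -‿distribʳ-*)
  open import Algebra.Properties.CommutativeSemigroup +-commutativeSemigroup using () renaming (interchange to ⊕-interchange)
  open import Relation.Binary.Reasoning.Setoid (𝒜-setoid n)

  Q′-central : ∀ (a : Tm n) → Q' ⊗ a ≈ a ⊗ Q'
  Q′-central a = begin
    Q' ⊗ a                    ≈⟨ ⊗-idʳ _ ⟨
    (Q' ⊗ a) ⊗ 𝟙              ≈⟨ ⊗-cong ≈-refl Q-invʳ ⟨
    (Q' ⊗ a) ⊗ (Q ⊗ Q')       ≈⟨ ⊗-assoc _ Q Q' ⟨
    ((Q' ⊗ a) ⊗ Q) ⊗ Q'       ≈⟨ ⊗-cong (⊗-assoc Q' a Q) ≈-refl ⟩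
    (Q' ⊗ (a ⊗ Q)) ⊗ Q'       ≈⟨ ⊗-cong (⊗-cong ≈-refl (Q-central a)) ≈-refl ⟨
    (Q' ⊗ (Q ⊗ a)) ⊗ Q'       ≈⟨ ⊗-cong (⊗-assoc Q' Q a) ≈-refl ⟨
    ((Q' ⊗ Q) ⊗ a) ⊗ Q'       ≈⟨ ⊗-cong (⊗-cong Q-invˡ ≈-refl) ≈-refl ⟩
    (𝟙 ⊗ a) ⊗ Q'              ≈⟨ ⊗-cong (⊗-idˡ a) ≈-refl ⟩
    a ⊗ Q'                    ∎

  Δ-central : ∀ (a : Tm n) → Δ ⊗ a ≈ a ⊗ Δ
  Δ-central a = begin
    (Q ⊕ ⊖ Q') ⊗ a            ≈⟨ distribʳ a Q (⊖ Q') ⟩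
    Q ⊗ a ⊕ (⊖ Q') ⊗ a        ≈⟨ ⊕-cong (Q-central a) (≈-sym (-‿distribˡ-* Q' a)) ⟩
    a ⊗ Q ⊕ ⊖ (Q' ⊗ a)        ≈⟨ ⊕-cong ≈-refl (⊖-cong (Q′-central a)) ⟩
    a ⊗ Q ⊕ ⊖ (a ⊗ Q')        ≈⟨ ⊕-cong ≈-refl (-‿distribʳ-* a Q') ⟩
    a ⊗ Q ⊕ a ⊗ (⊖ Q')        ≈⟨ distribˡ a Q (⊖ Q') ⟨
    a ⊗ (Q ⊕ ⊖ Q')            ∎

  ⊗-Δ-exchange : ∀ (a c : Tm n) → a ⊗ (Δ ⊗ c) ≈ Δ ⊗ (a ⊗ c)
  ⊗-Δ-exchange a c = begin
    a ⊗ (Δ ⊗ c)   ≈⟨ ⊗-assoc a Δ c ⟨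
    (a ⊗ Δ) ⊗ c   ≈⟨ ⊗-cong (Δ-central a) ≈-refl ⟨
    (Δ ⊗ a) ⊗ c   ≈⟨ ⊗-assoc Δ a c ⟩
    Δ ⊗ (a ⊗ c)   ∎

  natTm-+ : ∀ a b → natTm {n} (a + b) ≈ natTm a ⊕ natTm b
  natTm-+ ℕ.zero    b = ≈-sym (⊕-idˡ _)
  natTm-+ (ℕ.suc a) b = ≈-trans (⊕-cong ≈-refl (natTm-+ a b)) (≈-sym (⊕-assoc 𝟙 (natTm a) (natTm b)))

  sumTm-++ : ∀ (xs ys : List (Tm n)) → sumTm (xs ++ ys) ≈ sumTm xs ⊕ sumTm ys
  sumTm-++ []       ys = ≈-sym (⊕-idˡ _)
  sumTm-++ (x ∷ xs) ys = ≈-trans (⊕-cong ≈-refl (sumTm-++ xs ys)) (≈-sym (⊕-assoc x (sumTm xs) (sumTm ys)))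

  sumTm-map-cong : ∀ {f g : A → Tm n} (xs : List A) → (∀ x → f x ≈ g x) → sumTm (L.map f xs) ≈ sumTm (L.map g xs)
  sumTm-map-cong []       f≈g = ≈-refl
  sumTm-map-cong (x ∷ xs) f≈g = ⊕-cong (f≈g x) (sumTm-map-cong xs f≈g)

  sumTm-map-⊕ : ∀ (f g : A → Tm n) (xs : List A) →
                sumTm (L.map (λ x → f x ⊕ g x) xs) ≈ sumTm (L.map f xs) ⊕ sumTm (L.map g xs)
  sumTm-map-⊕ f g []       = ≈-sym (⊕-idˡ 𝟘)
  sumTm-map-⊕ f g (x ∷ xs) = ≈-trans (⊕-cong ≈-refl (sumTm-map-⊕ f g xs)) (⊕-interchange (f x) (g x) _ _)

  sumTm-map-*ˡ : ∀ (c : Tm n) (f : A → Tm n) (xs : List A) →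
                 sumTm (L.map (λ x → c ⊗ f x) xs) ≈ c ⊗ sumTm (L.map f xs)
  sumTm-map-*ˡ c f []       = ≈-sym (zeroʳ c)
  sumTm-map-*ˡ c f (x ∷ xs) = ≈-trans (⊕-cong ≈-refl (sumTm-map-*ˡ c f xs)) (≈-sym (distribˡ c (f x) _))

  sumTm-map-𝟘 : ∀ {f : A → Tm n} (xs : List A) → All (λ x → f x ≈ 𝟘) xs → sumTm (L.map f xs) ≈ 𝟘
  sumTm-map-𝟘 []       []           = ≈-refl
  sumTm-map-𝟘 (x ∷ xs) (fx≈0 ∷ f≈0) = ≈-trans (⊕-cong fx≈0 (sumTm-map-𝟘 xs f≈0)) (⊕-idˡ 𝟘)

  sumTm-map-single : ∀ {f : A → Tm n} (xs : List A) {v} → Unique xs → v ∈ xs → (∀ w → w ≢ v → f w ≈ 𝟘) →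
                     sumTm (L.map f xs) ≈ f v
  sumTm-map-single (x ∷ xs) (x∉xs ∷ _) (here refl) f≈0 =
    ≈-trans (⊕-cong ≈-refl (sumTm-map-𝟘 xs (All.map (λ {w} x≢w → f≈0 w (x≢w ∘ sym)) x∉xs))) (+-identityʳ _)
  sumTm-map-single (x ∷ xs) (x∉xs ∷ u) (there v∈xs) f≈0 =
    ≈-trans (⊕-cong (f≈0 x (λ x≡v → All.lookup x∉xs v∈xs x≡v)) (sumTm-map-single xs u v∈xs f≈0)) (⊕-idˡ _)

  ≡⇒≈ : ∀ {a b : Tm n} → a ≡ b → a ≈ b
  ≡⇒≈ = Setoid.reflexive (𝒜-setoid n)

  sumTm-map-concatMap : ∀ {B : Set} (f : B → Tm n) (g : A → List B) (xs : List A) →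
    sumTm (L.map f (L.concatMap g xs)) ≈ sumTm (L.map (λ x → sumTm (L.map f (g x))) xs)
  sumTm-map-concatMap f g []       = ≈-refl
  sumTm-map-concatMap f g (x ∷ xs) = begin
    sumTm (L.map f (g x ++ L.concatMap g xs))                  ≡⟨ cong sumTm (LP.map-++ f (g x) (L.concatMap g xs)) ⟩
    sumTm (L.map f (g x) ++ L.map f (L.concatMap g xs))        ≈⟨ sumTm-++ (L.map f (g x)) _ ⟩
    sumTm (L.map f (g x)) ⊕ sumTm (L.map f (L.concatMap g xs)) ≈⟨ ⊕-cong ≈-refl (sumTm-map-concatMap f g xs) ⟩
    sumTm (L.map f (g x)) ⊕ sumTm (L.map (λ x → sumTm (L.map f (g x))) xs) ∎

  sumTm-allVecs-single : ∀ k (f : Vec (Fin n) k → Tm n) (v : Vec (Fin n) k) → (∀ w → w ≢ v → f w ≈ 𝟘) →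
                         sumTm (L.map f (allVecs k)) ≈ f v
  sumTm-allVecs-single ℕ.zero    f []       _   = +-identityʳ (f [])
  sumTm-allVecs-single (ℕ.suc k) f (x ∷ v) f≈0 = begin
    sumTm (L.map f (allVecs (ℕ.suc k)))          ≈⟨ sumTm-map-concatMap f (λ y → L.map (y ∷_) (allVecs k)) (L.allFin n) ⟩
    sumTm (L.map row (L.allFin n))               ≈⟨ sumTm-map-single (L.allFin n) (UniqueP.allFin⁺ n) (∈-allFin x) row≈0 ⟩
    row x                                        ≡⟨ row≡ x ⟩
    sumTm (L.map (f ∘ (x ∷_)) (allVecs k))       ≈⟨ sumTm-allVecs-single k (f ∘ (x ∷_)) v (λ w w≢v → f≈0 (x ∷ w) (w≢v ∘ VecP.∷-injectiveʳ)) ⟩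
    f (x ∷ v)                                    ∎
    where
    row : Fin n → Tm n
    row y = sumTm (L.map f (L.map (y ∷_) (allVecs k)))
    row≡ : ∀ y → row y ≡ sumTm (L.map (f ∘ (y ∷_)) (allVecs k))
    row≡ y = cong sumTm (sym (LP.map-∘ (allVecs k)))
    row≈0 : ∀ y → y ≢ x → row y ≈ 𝟘
    row≈0 y y≢x = ≈-trans (≡⇒≈ (row≡ y))
      (sumTm-map-𝟘 (allVecs k) (All.universal (λ w → f≈0 (y ∷ w) (y≢x ∘ VecP.∷-injectiveˡ)) (allVecs k)))

  sumTm-filter-single : ∀ {P : A → Set} (P? : ∀ x → Dec (P x)) {f : A → Tm n} (xs : List A) {v} → P v →
                        (∀ w → w ≢ v → f w ≈ 𝟘) → sumTm (L.map f (L.filter P? xs)) ≈ sumTm (L.map f xs)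
  sumTm-filter-single P? []       pv f≈0 = ≈-refl
  sumTm-filter-single P? (x ∷ xs) pv f≈0 with P? x
  ... | yes _  = ⊕-cong ≈-refl (sumTm-filter-single P? xs pv f≈0)
  ... | no ¬px = ≈-trans (sumTm-filter-single P? xs pv f≈0)
                         (≈-trans (≈-sym (⊕-idˡ _)) (⊕-cong (≈-sym (f≈0 x λ { refl → ¬px pv })) ≈-refl))

  sumTm-Sn-single : ∀ (f : Word n → Tm n) (v : Word n) → IsPerm v → (∀ w → w ≢ v → f w ≈ 𝟘) →
                    sumTm (L.map f (Sn n)) ≈ f v
  sumTm-Sn-single f v pv f≈0 =
    ≈-trans (sumTm-filter-single (λ w → UniqueD.unique? FinP._≟_ (toList w)) (allVecs n) pv f≈0)
            (sumTm-allVecs-single n f v f≈0)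

  term : (ℕ → ℕ) → ℕ → Tm n
  term c b = natTm (c b) ⊗ (Δ ^ₜ b)

  sumTm-upTo-suc : ∀ (g : ℕ → Tm n) k → sumTm (L.map g (L.upTo (ℕ.suc k))) ≡ g 0 ⊕ sumTm (L.map (g ∘ ℕ.suc) (L.upTo k))
  sumTm-upTo-suc g k = cong (λ xs → g 0 ⊕ sumTm xs) (trans (LP.map-applyUpTo ℕ.suc g k) (sym (LP.map-applyUpTo id (g ∘ ℕ.suc) k)))

  polyAtΔ-cong : ∀ k {c c′ : ℕ → ℕ} → (∀ b → c b ≡ c′ b) → polyAtΔ {n} k c ≈ polyAtΔ k c′
  polyAtΔ-cong k c≡c′ = sumTm-map-cong (L.upTo (ℕ.suc k)) (λ b → ≡⇒≈ (cong (λ z → natTm z ⊗ (Δ ^ₜ b)) (c≡c′ b)))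

  polyAtΔ-extend : ∀ k (c : ℕ → ℕ) → c (ℕ.suc k) ≡ 0 → polyAtΔ {n} (ℕ.suc k) c ≈ polyAtΔ k c
  polyAtΔ-extend k c c≡0 = begin
    sumTm (L.map (term c) (L.upTo (ℕ.suc (ℕ.suc k))))                ≡⟨ cong (sumTm ∘ L.map (term c)) (sym (LP.upTo-∷ʳ (ℕ.suc k))) ⟩
    sumTm (L.map (term c) (L.upTo (ℕ.suc k) ++ ℕ.suc k ∷ []))        ≡⟨ cong sumTm (LP.map-++ (term c) (L.upTo (ℕ.suc k)) _) ⟩
    sumTm (L.map (term c) (L.upTo (ℕ.suc k)) ++ term c (ℕ.suc k) ∷ []) ≈⟨ sumTm-++ (L.map (term c) (L.upTo (ℕ.suc k))) _ ⟩
    polyAtΔ k c ⊕ (term c (ℕ.suc k) ⊕ 𝟘)                              ≈⟨ ⊕-cong ≈-refl (≈-trans (+-identityʳ _) last≈0) ⟩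
    polyAtΔ k c ⊕ 𝟘                                                    ≈⟨ +-identityʳ _ ⟩
    polyAtΔ k c                                                        ∎
    where
    last≈0 : term c (ℕ.suc k) ≈ 𝟘
    last≈0 = ≈-trans (⊗-cong (≡⇒≈ (cong natTm c≡0)) ≈-refl) (zeroˡ _)

  polyAtΔ-raise : ∀ k (c₁ c₂ : ℕ → ℕ) →
    polyAtΔ {n} (ℕ.suc k) (λ b → c₁ b + shift 0 c₂ b) ≈ polyAtΔ (ℕ.suc k) c₁ ⊕ Δ ⊗ polyAtΔ k c₂
  polyAtΔ-raise k c₁ c₂ = begin
    polyAtΔ (ℕ.suc k) c                                                      ≡⟨ sumTm-upTo-suc (term c) (ℕ.suc k) ⟩
    term c 0 ⊕ sumTm (L.map (term c ∘ ℕ.suc) L)                              ≈⟨ ⊕-cong term₀ (sumTm-map-cong L term-suc) ⟩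
    term c₁ 0 ⊕ sumTm (L.map (λ b → term c₁ (ℕ.suc b) ⊕ Δ ⊗ term c₂ b) L)   ≈⟨ ⊕-cong ≈-refl (sumTm-map-⊕ (term c₁ ∘ ℕ.suc) _ L) ⟩
    term c₁ 0 ⊕ (sumTm (L.map (term c₁ ∘ ℕ.suc) L) ⊕ sumTm (L.map (λ b → Δ ⊗ term c₂ b) L))
      ≈⟨ ⊕-cong ≈-refl (⊕-cong ≈-refl (sumTm-map-*ˡ Δ (term c₂) L)) ⟩
    term c₁ 0 ⊕ (sumTm (L.map (term c₁ ∘ ℕ.suc) L) ⊕ Δ ⊗ polyAtΔ k c₂)    ≈⟨ ⊕-assoc _ _ _ ⟨
    (term c₁ 0 ⊕ sumTm (L.map (term c₁ ∘ ℕ.suc) L)) ⊕ Δ ⊗ polyAtΔ k c₂    ≡⟨ cong (_⊕ Δ ⊗ polyAtΔ k c₂) (sym (sumTm-upTo-suc (term c₁) (ℕ.suc k))) ⟩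
    polyAtΔ (ℕ.suc k) c₁ ⊕ Δ ⊗ polyAtΔ k c₂                                 ∎
    where
    c : ℕ → ℕ
    c b = c₁ b + shift 0 c₂ b
    L = L.upTo (ℕ.suc k)
    term₀ : term c 0 ≈ term c₁ 0
    term₀ = ⊗-cong (≡⇒≈ (cong natTm (ℕP.+-identityʳ (c₁ 0)))) ≈-refl
    term-suc : ∀ b → term c (ℕ.suc b) ≈ term c₁ (ℕ.suc b) ⊕ Δ ⊗ term c₂ b
    term-suc b = begin
      natTm (c₁ (ℕ.suc b) + c₂ b) ⊗ (Δ ⊗ (Δ ^ₜ b))                   ≈⟨ ⊗-cong (natTm-+ (c₁ (ℕ.suc b)) (c₂ b)) ≈-refl ⟩
      (natTm (c₁ (ℕ.suc b)) ⊕ natTm (c₂ b)) ⊗ (Δ ⊗ (Δ ^ₜ b))         ≈⟨ distribʳ _ _ _ ⟩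
      term c₁ (ℕ.suc b) ⊕ natTm (c₂ b) ⊗ (Δ ⊗ (Δ ^ₜ b))              ≈⟨ ⊕-cong ≈-refl (⊗-Δ-exchange (natTm (c₂ b)) (Δ ^ₜ b)) ⟩
      term c₁ (ℕ.suc b) ⊕ Δ ⊗ term c₂ b                               ∎

  prod : Vec (Fin n) k → Vec (Fin n) k → Tm n
  prod a b = L.foldr _⊗_ 𝟙 (toList (Vec.zipWith X a b))

  prod-swap-ascent : ∀ (j : Fin k) (a b : Vec (Fin n) (ℕ.suc k)) → Ascent j a → Ascent j b →
                     prod (swap j a) b ≈ prod a (swap j b)
  prod-swap-ascent zero (a₀ ∷ a₁ ∷ a) (b₀ ∷ b₁ ∷ b) a₀<a₁ b₀<b₁ = begin
    X a₁ b₀ ⊗ (X a₀ b₁ ⊗ prod a b)   ≈⟨ ⊗-assoc _ _ _ ⟨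
    (X a₁ b₀ ⊗ X a₀ b₁) ⊗ prod a b   ≈⟨ ⊗-cong (rel₂ a₀<a₁ b₀<b₁) ≈-refl ⟩
    (X a₀ b₁ ⊗ X a₁ b₀) ⊗ prod a b   ≈⟨ ⊗-assoc _ _ _ ⟩
    X a₀ b₁ ⊗ (X a₁ b₀ ⊗ prod a b)   ∎
  prod-swap-ascent (suc j) (x ∷ a) (y ∷ b) asc-a asc-b = ⊗-cong ≈-refl (prod-swap-ascent j a b asc-a asc-b)

  prod-swap-descent : ∀ (j : Fin k) (a b : Vec (Fin n) (ℕ.suc k)) → Ascent j a → Descent j b →
                      prod (swap j a) b ≈ prod a (swap j b) ⊕ Δ ⊗ prod a b
  prod-swap-descent zero (a₀ ∷ a₁ ∷ a) (b₀ ∷ b₁ ∷ b) a₀<a₁ b₁<b₀ = begin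
    X a₁ b₀ ⊗ (X a₀ b₁ ⊗ P)                                              ≈⟨ ⊗-assoc _ _ _ ⟨
    (X a₁ b₀ ⊗ X a₀ b₁) ⊗ P                                              ≈⟨ ⊗-cong (rel₄ a₀<a₁ b₁<b₀) ≈-refl ⟩
    (X a₀ b₁ ⊗ X a₁ b₀ ⊕ Δ ⊗ (X a₀ b₀ ⊗ X a₁ b₁)) ⊗ P                    ≈⟨ distribʳ _ _ _ ⟩
    (X a₀ b₁ ⊗ X a₁ b₀) ⊗ P ⊕ (Δ ⊗ (X a₀ b₀ ⊗ X a₁ b₁)) ⊗ P             ≈⟨ ⊕-cong (⊗-assoc _ _ _)
                                                                              (≈-trans (⊗-assoc _ _ _) (⊗-cong ≈-refl (⊗-assoc _ _ _))) ⟩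
    X a₀ b₁ ⊗ (X a₁ b₀ ⊗ P) ⊕ Δ ⊗ (X a₀ b₀ ⊗ (X a₁ b₁ ⊗ P))             ∎
    where P = prod a b
  prod-swap-descent (suc j) (x ∷ a) (y ∷ b) asc-a desc-b = begin
    X x y ⊗ prod (swap j a) b                                         ≈⟨ ⊗-cong ≈-refl (prod-swap-descent j a b asc-a desc-b) ⟩
    X x y ⊗ (prod a (swap j b) ⊕ Δ ⊗ prod a b)                        ≈⟨ distribˡ _ _ _ ⟩
    X x y ⊗ prod a (swap j b) ⊕ X x y ⊗ (Δ ⊗ prod a b)                ≈⟨ ⊕-cong ≈-refl (⊗-Δ-exchange (X x y) (prod a b)) ⟩
    X x y ⊗ prod a (swap j b) ⊕ Δ ⊗ (X x y ⊗ prod a b)                ∎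

  expand : ℕ → (Word n → ℕ → ℕ) → Word n → Tm n
  expand k c t = sumTm (L.map (λ w → polyAtΔ k (c w) ⊗ xuv t w) (Sn n))

  expand-cong : ∀ k {c c′ : Word n → ℕ → ℕ} t → (∀ w b → c w b ≡ c′ w b) → expand k c t ≈ expand k c′ t
  expand-cong k t c≡c′ = sumTm-map-cong (Sn n) (λ w → ⊗-cong (polyAtΔ-cong k (c≡c′ w)) ≈-refl)

  expand-extend : ∀ k (c : Word n → ℕ → ℕ) t → (∀ w → c w (ℕ.suc k) ≡ 0) → expand (ℕ.suc k) c t ≈ expand k c t
  expand-extend k c t c≡0 = sumTm-map-cong (Sn n) (λ w → ⊗-cong (polyAtΔ-extend k (c w) (c≡0 w)) ≈-refl)

  expand-raise : ∀ k (c₁ c₂ : Word n → ℕ → ℕ) t →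
    expand (ℕ.suc k) (λ w b → c₁ w b + shift 0 (c₂ w) b) t ≈ expand (ℕ.suc k) c₁ t ⊕ Δ ⊗ expand k c₂ t
  expand-raise k c₁ c₂ t = begin
    expand (ℕ.suc k) (λ w b → c₁ w b + shift 0 (c₂ w) b) t
      ≈⟨ sumTm-map-cong (Sn n) split ⟩
    sumTm (L.map (λ w → polyAtΔ (ℕ.suc k) (c₁ w) ⊗ xuv t w ⊕ Δ ⊗ (polyAtΔ k (c₂ w) ⊗ xuv t w)) (Sn n))
      ≈⟨ sumTm-map-⊕ _ _ (Sn n) ⟩
    expand (ℕ.suc k) c₁ t ⊕ sumTm (L.map (λ w → Δ ⊗ (polyAtΔ k (c₂ w) ⊗ xuv t w)) (Sn n))
      ≈⟨ ⊕-cong ≈-refl (sumTm-map-*ˡ Δ _ (Sn n)) ⟩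
    expand (ℕ.suc k) c₁ t ⊕ Δ ⊗ expand k c₂ t ∎
    where
    split : ∀ w → polyAtΔ (ℕ.suc k) (λ b → c₁ w b + shift 0 (c₂ w) b) ⊗ xuv t w
                  ≈ polyAtΔ (ℕ.suc k) (c₁ w) ⊗ xuv t w ⊕ Δ ⊗ (polyAtΔ k (c₂ w) ⊗ xuv t w)
    split w = ≈-trans (⊗-cong (polyAtΔ-raise k (c₁ w) (c₂ w)) ≈-refl)
                      (≈-trans (distribʳ _ _ _) (⊕-cong ≈-refl (⊗-assoc _ _ _)))

  polyAtΔ-0 : ∀ (c : ℕ → ℕ) → polyAtΔ {n} 0 c ≈ natTm (c 0)
  polyAtΔ-0 c = ≈-trans (+-identityʳ _) (⊗-idʳ _)

  xuv≈expand-δ : ∀ (t v : Word n) → IsPerm v → xuv t v ≈ expand 0 (δ v) t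
  xuv≈expand-δ t v pv = ≈-sym (≈-trans (sumTm-Sn-single _ v pv vanishes) at-v)
    where
    vanishes : ∀ w → w ≢ v → polyAtΔ 0 (δ v w) ⊗ xuv t w ≈ 𝟘
    vanishes w w≢v = ≈-trans (⊗-cong (≈-trans (polyAtΔ-0 (δ v w))
                                               (≡⇒≈ (cong natTm (trans (δ-zero v w) (when-no (v ≟W w) (w≢v ∘ sym) 1)))))
                                     ≈-refl)
                             (zeroˡ _)
    at-v : polyAtΔ 0 (δ v v) ⊗ xuv t v ≈ xuv t v
    at-v = ≈-trans (⊗-cong (≈-trans (polyAtΔ-0 (δ v v))
                                    (≡⇒≈ (cong natTm (trans (δ-zero v v) (when-yes (v ≟W v) refl 1)))))
                           ≈-refl)
                   (≈-trans (⊗-cong (+-identityʳ 𝟙) ≈-refl) (⊗-idˡ _))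

-- The expansion of x^{u,v}

-- For t ≤_W u = eval e · t this says ℓ(u) = ℓ(u t⁻¹) + ℓ(t), with ℓ = inversions.
LengthAdditive : ∀ {n} → List (Gen n) → Word n → Set
LengthAdditive e t = inversions (eval e · t) ≡ length e + inversions t

lengthAdditive-∷ : ∀ (j : Fin m) e (t : Word (ℕ.suc m)) → IsPerm t → LengthAdditive (j ∷ e) t →
                   Ascent j (eval e · t) × LengthAdditive e t
lengthAdditive-∷ j e t pt add = ascent , additive
  where
  open ℕP.≤-Reasoning
  u = eval e · t
  pu : IsPerm u
  pu = ·-isPerm (eval e) t (eval-isPerm e) pt
  inversions-swap-u : inversions (swap j u) ≡ ℕ.suc (length e + inversions t)
  inversions-swap-u = trans (cong inversions (sym (trans (·-assoc (gen j) (eval e) t) (gen·≡swap j u)))) add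
  additive : inversions u ≡ length e + inversions t
  additive = ℕP.≤-antisym (inversions-eval·-≤ e t pt)
    (ℕP.≤-pred (ℕP.≤-trans (ℕP.≤-reflexive (sym inversions-swap-u)) (inversions-swap-≤ j u pu)))
  ascent : Ascent j u
  ascent = ¬descent⇒ascent j u pu λ d → ℕP.<-irrefl refl (begin-strict
    ℕ.suc (length e + inversions t)  ≡⟨ sym inversions-swap-u ⟩
    inversions (swap j u)            <⟨ ℕP.≤-reflexive (inversions-swap-descent j u d) ⟩
    inversions u                     ≡⟨ additive ⟩
    length e + inversions t          <⟨ ℕP.n<1+n _ ⟩
    ℕ.suc (length e + inversions t)  ∎)

xuv-expansion : ∀ {n} (t : Word n) (e : List (Gen n)) (v : Word n) → IsPerm t → IsPerm v →
                LengthAdditive e t → xuv (eval e · t) v ≈ expand (length e) (count e v) t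
xuv-expansion t [] v pt pv _ = ≈-trans (≡⇒≈ (cong (λ u → xuv u v) (·-identityˡ t))) (xuv≈expand-δ t v pv)
xuv-expansion {ℕ.suc m} t (j ∷ e) v pt pv add =
  ≈-trans (≡⇒≈ (cong (λ u → xuv u v) (trans (·-assoc (gen j) (eval e) t) (gen·≡swap j u))))
          (by-cases (ascent-or-descent j v pv))
  where
  open import Relation.Binary.Reasoning.Setoid (𝒜-setoid (ℕ.suc m))
  u = eval e · t
  ℓ = length e
  asc-u : Ascent j u
  asc-u = proj₁ (lengthAdditive-∷ j e t pt add)
  add-e : LengthAdditive e t
  add-e = proj₂ (lengthAdditive-∷ j e t pt add)
  c↑ c : Word (ℕ.suc m) → ℕ → ℕ
  c↑ = count e (gen j · v)
  c  = count e v
  c↑-extends : expand (ℕ.suc ℓ) c↑ t ≈ expand ℓ c↑ t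
  c↑-extends = expand-extend ℓ c↑ t (λ w → count-vanishes e (gen j · v) w (ℕ.suc ℓ) ℕP.≤-refl)
  by-cases : Ascent j v ⊎ Descent j v → xuv (swap j u) v ≈ expand (ℕ.suc ℓ) (count (j ∷ e) v) t
  by-cases (inj₁ asc-v) = begin
    xuv (swap j u) v                  ≈⟨ prod-swap-ascent j u v asc-u asc-v ⟩
    xuv u (swap j v)                  ≡⟨ cong (xuv u) (sym (gen·≡swap j v)) ⟩
    xuv u (gen j · v)                 ≈⟨ xuv-expansion t e (gen j · v) pt (gen·-isPerm j v pv) add-e ⟩
    expand ℓ c↑ t                     ≈⟨ c↑-extends ⟨
    expand (ℕ.suc ℓ) c↑ t             ≈⟨ expand-cong (ℕ.suc ℓ) t (λ w b → sym (trans (count-∷ j e v w b)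
                                           (trans (cong (c↑ w b +_) (when-no (descent? j v) (FinP.<-asym asc-v) _))
                                                  (ℕP.+-identityʳ _)))) ⟩
    expand (ℕ.suc ℓ) (count (j ∷ e) v) t ∎
  by-cases (inj₂ desc-v) = begin
    xuv (swap j u) v                                       ≈⟨ prod-swap-descent j u v asc-u desc-v ⟩
    xuv u (swap j v) ⊕ Δ ⊗ xuv u v                         ≡⟨ cong (λ x → xuv u x ⊕ Δ ⊗ xuv u v) (sym (gen·≡swap j v)) ⟩
    xuv u (gen j · v) ⊕ Δ ⊗ xuv u v                        ≈⟨ ⊕-cong (xuv-expansion t e (gen j · v) pt (gen·-isPerm j v pv) add-e)
                                                                     (⊗-cong ≈-refl (xuv-expansion t e v pt pv add-e)) ⟩
    expand ℓ c↑ t ⊕ Δ ⊗ expand ℓ c t                       ≈⟨ ⊕-cong c↑-extends ≈-refl ⟨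
    expand (ℕ.suc ℓ) c↑ t ⊕ Δ ⊗ expand ℓ c t               ≈⟨ expand-raise ℓ c↑ c t ⟨
    expand (ℕ.suc ℓ) (λ w b → c↑ w b + shift 0 (c w) b) t  ≈⟨ expand-cong (ℕ.suc ℓ) t (λ w b → sym (trans (count-∷ j e v w b)
                                                                (cong (c↑ w b +_) (when-yes (descent? j v) desc-v _)))) ⟩
    expand (ℕ.suc ℓ) (count (j ∷ e) v) t                    ∎

reducedQuot⇒reduced : ∀ {n} (e : List (Gen n)) {u t : Word n} → ReducedQuot e u t → Reduced e (eval e)
reducedQuot⇒reduced e {t = t} (ev , minimal) = refl , λ e′ ev′ → minimal e′ (trans (cong (_· t) ev′) ev)

reducedQuot-count-independent : ∀ {n} {u : Word n} (t : Word n) → IsPerm t → ∀ e e′ →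
  ReducedQuot e u t → ReducedQuot e′ u t → ∀ v → IsPerm v → count e v ≈ᶜ count e′ v
reducedQuot-count-independent {u = u} t pt e e′ rq rq′ =
  count-independent e e′ (reducedQuot⇒reduced e {u} {t} rq) (reducedQuot⇒reduced e′ {u} {t} rq′)
    (·-cancelʳ (eval e) (eval e′) t pt (trans (proj₁ rq) (sym (proj₁ rq′))))

≤W⇒lengthAdditive : ∀ {n} (t u : Word n) → IsPerm t → IsPerm u → t ≤W u →
                    ∀ e → ReducedQuot e u t → LengthAdditive e t
≤W⇒lengthAdditive t u pt pu (e₁ , e₂ , re₂ , re₁₂) e (ev , minimal) = begin
  inversions (eval e · t)   ≡⟨ cong inversions ev ⟩
  inversions u              ≡⟨ inversions-u ⟩
  length e₁ + inversions t  ≡⟨ cong (_+ inversions t) (ℕP.≤-antisym e₁≤e e≤e₁) ⟩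
  length e + inversions t   ∎
  where
  open ≡-Reasoning
  e≤e₁ : length e ≤ length e₁
  e≤e₁ = minimal e₁ (trans (cong (eval e₁ ·_) (sym (proj₁ re₂))) (trans (sym (eval-++ e₁ e₂)) (proj₁ re₁₂)))
  inversions-u : inversions u ≡ length e₁ + inversions t
  inversions-u = trans (sym (reduced⇒length≡inversions (e₁ ++ e₂) u pu re₁₂))
                       (trans (LP.length-++ e₁) (cong (length e₁ +_) (reduced⇒length≡inversions e₂ t pt re₂)))
  e₁≤e : length e₁ ≤ length e
  e₁≤e = ℕP.+-cancelʳ-≤ (inversions t) _ _
    (ℕP.≤-trans (ℕP.≤-reflexive (trans (sym inversions-u) (cong inversions (sym ev)))) (inversions-eval·-≤ e t pt))

theorem2p6 : ∀ (n : ℕ) (t u : Word n) → IsPerm t → IsPerm u → t ≤W u →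
    (∀ (e : List (Gen n)) → ReducedQuot e u t → ∀ (v : Word n) → IsPerm v →
      Σ (Word n → ℕ → ℕ) λ c →
        (∀ (w : Word n) → IsPerm w → ∀ (b : ℕ) → HasSize (InC e v w b) (c w b))
        × (xuv u v ≈ sumTm (map (λ w → polyAtΔ (length e) (c w) ⊗ xuv t w) (Sn n))))
    × (∀ (e e' : List (Gen n)) → ReducedQuot e u t → ReducedQuot e' u t →
        ∀ (v w : Word n) → IsPerm v → IsPerm w → ∀ (b m : ℕ) →
        HasSize (InC e v w b) m → HasSize (InC e' v w b) m)
theorem2p6 n t u pt pu t≤u =
    (λ e rq v pv →
         count e v
       , (λ w _ b → count-hasSize e v w b pv)
       , subst (λ u′ → xuv u′ v ≈ expand (length e) (count e v) t) (proj₁ rq)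
               (xuv-expansion t e v pt pv (≤W⇒lengthAdditive t u pt pu t≤u e rq)))
  , λ e e′ rq rq′ v w pv pw b s hs →
      subst (HasSize (InC e′ v w b))
            (trans (sym (reducedQuot-count-independent t pt e e′ rq rq′ v pv w pw b))
                   (hasSize-unique (count-hasSize e v w b pv) hs))
            (count-hasSize e′ v w b pv)
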